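{- Let $q$ be a prime power, $n\ge2$ and $m\ge1$ integers, $\beta\in\mathbb{F}_{q^n}^*$, and $j\in\{1,\dots,m\}$. Let $e$ be a divisor of $q^n-1$ and let $p_1,\dots,p_r$ be all the primes dividing $q^n-1$ but not $e$. Let $g\in\mathbb{F}_q[x]$ be a monic divisor of $x^n-1$ and let $h_1,\dots,h_s$ be all the monic irreducible polynomials in $\mathbb{F}_q[x]$ dividing $x^n-1$ but not $g$. Writing $\bar e=(e,\dots,e)$ ($m$ entries) and $\overline{q^n-1}=(q^n-1,\dots,q^n-1)$, we have \[ N_j(\overline{q^n-1},x^n-1)\ \ge\ \sum_{k=1}^{m}\sum_{i=1}^{r}N_j(e,\dots,e,\underbrace{p_ie}_{k\text{ -th}},e,\dots,e,g)+\sum_{i=1}^{s}N_j(\bar e,h_ig)-(mr+s-1)N_j(\bar e,g). \]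
   Context: For a divisor $e$ of $q^n-1$, an element $\alpha\in\mathbb{F}_{q^n}^*$ is $e$-free if for every divisor $d\ne1$ of $e$ there is no $\gamma\in\mathbb{F}_{q^n}$ with $\alpha=\gamma^d$. $\mathbb{F}_{q^n}$ is an $\mathbb{F}_q[x]$-module via $f\circ\alpha=\sum_i a_i\alpha^{q^i}$ for $f=\sum_i a_ix^i$; for a monic divisor $g$ of $x^n-1$, $\alpha\in\mathbb{F}_{q^n}$ is $g$-free if for every monic $h\mid g$, $h\ne1$, there is no $\gamma$ with $\alpha=h\circ\gamma$. For divisors $e_1,\dots,e_m$ of $q^n-1$ and a monic divisor $g$ of $x^n-1$, $N_j(e_1,\dots,e_m,g)$ is the number of $\alpha\in\mathbb{F}_{q^n}$ such that $\alpha+(i-1)\beta$ is $e_i$-free for all $i\in\{1,\dots,m\}$ and $\alpha+(j-1)\beta$ is $g$-free. -}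

module Defs where

open import Level using (0ℓ)
open import Data.Nat as ℕ using (ℕ; zero; suc; _∸_; _≤_)
open import Data.Nat.Divisibility using (_∣_)
open import Data.Nat.Primality using (Prime)
open import Data.Fin as Fin using (Fin; toℕ)
open import Data.List as List using (List; []; _∷_; _++_; [_]; map; replicate; length; sum; allFin)
open import Data.List.Relation.Unary.All using (All)
open import Data.List.Relation.Unary.Unique.Propositional using (Unique)
open import Data.List.Membership.Propositional using (_∈_)
open import Data.Product using (Σ; ∃; ∃-syntax; _×_; _,_)
open import Data.Sum using (_⊎_)
open import Data.Bool using (if_then_else_)
open import Relation.Nullary using (¬_; does)
open import Relation.Binary.PropositionalEquality using (_≡_; _≢_)
open import Relation.Binary.Definitions using (DecidableEquality)
open import Algebra.Structures using (IsCommutativeRing)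
open import Function.Bundles using (_⇔_)

record FiniteField : Set₁ where
  infixl 6 _+_
  infixl 7 _*_
  field
    K      : Set
    _≟_    : DecidableEquality K
    _+_ _*_ : K → K → K
    -_     : K → K
    0# 1#  : K
    isCommutativeRing : IsCommutativeRing _≡_ _+_ _*_ -_ 0# 1#
    0≢1    : 0# ≢ 1#
    inverse : ∀ x → x ≢ 0# → ∃[ y ] (x * y ≡ 1#)
    elems  : List K
    elems-unique   : Unique elems
    elems-complete : ∀ x → x ∈ elems

  card : ℕ
  card = length elems

IsPrimePower : ℕ → Set
IsPrimePower q = ∃[ p ] ∃[ k ] (Prime p × 1 ≤ k × q ≡ p ℕ.^ k)

HasCard : {A : Set} → (A → Set) → ℕ → Set
HasCard {A} P c = ∃[ xs ] (Unique xs × (∀ x → (x ∈ xs) ⇔ P x) × length xs ≡ c)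

setAt : {A : Set} {m : ℕ} → (Fin m → A) → Fin m → A → (Fin m → A)
setAt {m = m} f k v i = if does (i Fin.≟ k) then v else f i

module FieldDefs (F : FiniteField) (q : ℕ) where
  open FiniteField F

  _^_ : K → ℕ → K
  x ^ zero  = 1#
  x ^ suc k = x * (x ^ k)

  _·_ : ℕ → K → K
  zero  · x = 0#
  suc k · x = x + (k · x)

  InFq : K → Set
  InFq x = x ^ q ≡ x

  -- Polynomials are coefficient lists (constant term first).
  -- A polynomial lies in F_q[x] iff all its coefficients lie in F_q.
  Poly : Set
  Poly = List K

  InFqPoly : Poly → Set
  InFqPoly = All InFq

  _+ₚ_ : Poly → Poly → Poly
  []       +ₚ g        = g
  (a ∷ f)  +ₚ []       = a ∷ f
  (a ∷ f)  +ₚ (b ∷ g)  = (a + b) ∷ (f +ₚ g)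

  _*ₚ_ : Poly → Poly → Poly
  []      *ₚ g = []
  (a ∷ f) *ₚ g = map (a *_) g +ₚ (0# ∷ (f *ₚ g))

  oneₚ : Poly
  oneₚ = 1# ∷ []

  -- x^n - 1  (for n ≥ 1)
  xⁿ-1 : ℕ → Poly
  xⁿ-1 n = (- 1#) ∷ (replicate (ℕ.pred n) 0# ++ (1# ∷ []))

  MonicFq : Poly → Set
  MonicFq f = InFqPoly f × ∃[ cs ] (f ≡ cs ++ (1# ∷ []))

  -- divisibility in F_q[x] (used for monic polynomials, which have no
  -- trailing zero coefficients, so list equality is polynomial equality)
  _∣ₚ_ : Poly → Poly → Set
  h ∣ₚ g = ∃[ k ] (InFqPoly k × h *ₚ k ≡ g)

  MonicIrreducible : Poly → Set
  MonicIrreducible h =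
    MonicFq h × h ≢ oneₚ ×
    (∀ a b → InFqPoly a → InFqPoly b → a *ₚ b ≡ h →
       length a ≤ 1 ⊎ length b ≤ 1)

  -- module action  f ∘ α = Σ_i a_i α^{q^i}
  _∘ₚ_ : Poly → K → K
  []      ∘ₚ α = 0#
  (a ∷ f) ∘ₚ α = a * α + (f ∘ₚ (α ^ q))

  EFree : ℕ → K → Set
  EFree e α = α ≢ 0# × (∀ d → d ∣ e → d ≢ 1 → ¬ (∃[ γ ] (α ≡ γ ^ d)))

  GFree : Poly → K → Set
  GFree g α = ∀ h → MonicFq h → h ∣ₚ g → h ≢ oneₚ → ¬ (∃[ γ ] (α ≡ h ∘ₚ γ))

  -- the set counted by N_j(e_1,…,e_m,g)   (index i : Fin m stands for i+1)
  NSet : (m : ℕ) → K → Fin m → (Fin m → ℕ) → Poly → K → Set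
  NSet m β j es g α =
    (∀ (i : Fin m) → EFree (es i) (α + (toℕ i · β))) × GFree g (α + (toℕ j · β))

{-# OPTIONS --safe #-}
-- Let S be the set counted by N_j(ē, g), T the one counted by N_j(q̄ⁿ-1, xⁿ-1), and A₁, …, A_M
-- (M = mr + s) the sets counted in the two sums. Every Aᵢ lies in S and S ∩ A₁ ∩ … ∩ A_M ⊆ T, so
-- 1_{A₁} + … + 1_{A_M} + 1_S ≤ 1_T + M · 1_S pointwise, and summing over the field gives the claim.
-- For S ∩ ⋂ Aᵢ ⊆ T: a d-th power with d ∣ qⁿ-1, d ≠ 1, is a p-th power for a prime p ∣ d, which
-- e-freeness excludes if p ∣ e and (p e)-freeness otherwise; and if α = h ∘ γ for a monic divisor
-- h ≠ 1 of xⁿ-1, splitting off factors of h gives α = P ∘ γ′ for a monic irreducible divisor P of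
-- xⁿ-1, which divides g (excluded by g-freeness) or is some hᵢ (excluded by (hᵢ g)-freeness).
-- Splitting uses (a b) ∘ γ = a ∘ (b ∘ γ), which holds because x ↦ x^q is additive: the field has
-- characteristic p and q is a power of p.
module Submission where

open import Defs
open import Level using (0ℓ)
open import Function.Base using (id; _∘_; case_of_)
open import Function.Bundles using (_⇔_; mk⇔; Equivalence)
open import Data.Empty using (⊥-elim)
open import Data.Product using (∃; ∃-syntax; _×_; _,_; proj₁; proj₂; uncurry)
open import Data.Sum using (_⊎_; inj₁; inj₂)
open import Relation.Nullary using (¬_; Dec; yes; no; _×-dec_)
open import Relation.Unary using (Pred; Decidable; _⊆_)
open import Relation.Binary.Bundles using (Setoid)
open import Relation.Binary.Definitions using (DecidableEquality)
open import Relation.Binary.PropositionalEquality using (_≡_; _≢_; refl; sym; trans; cong; cong₂; subst; subst₂; module ≡-Reasoning)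
import Relation.Binary.PropositionalEquality as ≡
import Relation.Binary.Reasoning.Setoid as SetoidReasoning

open import Data.Nat as ℕ using (ℕ; zero; suc; _≤_; _<_; _∸_; _⊔_; z≤n; s≤s)
open import Data.Nat.Base using (_!; nonTrivial⇒n>1)
import Data.Nat.Properties as ℕP
open import Data.Nat.Properties using (_!*_!≢0)
open import Data.Nat.Divisibility using (_∣_; divides; _∣?_; ∣-refl; ∣⇒≤; ∣1⇒≡1; 0∣⇒≡0; m∣m*n; n∣m*n; ∣-trans)
open import Data.Nat.DivMod using (m/n*n≡m)
open import Data.Nat.Primality using (Prime; euclidsLemma; ¬prime[1]; prime⇒nonZero; prime⇒nonTrivial)
open import Data.Nat.Primality.Factorisation using (factorise)
open import Data.Nat.Combinatorics using (_C_; nCk≡n!/k![n-k]!; k![n∸k]!∣n!; nCn≡1)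
open import Data.Nat.ListAction using (sum)
open import Data.Nat.ListAction.Properties using (sum-++)
open import Data.Fin as Fin using (Fin; toℕ; fromℕ; inject₁)
import Data.Fin.Properties as FinP

open import Data.List as List using (List; []; _∷_; _++_; map; length; filter; allFin; cartesianProductWith)
import Data.List.Properties as ListP
open import Data.List.Relation.Unary.All as All using (All; []; _∷_)
import Data.List.Relation.Unary.All.Properties as AllP
open import Data.List.Relation.Unary.All.Properties.Core using (¬All⇒Any¬)
open import Data.List.Relation.Unary.Any as Any using (Any; here; there)
open import Data.List.Relation.Unary.Unique.Propositional using (Unique)
import Data.List.Relation.Unary.Unique.Propositional.Properties as UniqueP
open import Data.List.Membership.Propositional using (_∈_; lose)
open import Data.List.Membership.Propositional.Properties using (∈-filter⁺; ∈-filter⁻; ∈-map⁺; ∈-concatMap⁺; ∈-allFin)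
open import Data.List.Membership.Propositional.Properties.WithK using (unique∧set⇒bag)
import Data.List.Membership.DecPropositional as DecMembership
open import Data.List.Relation.Binary.BagAndSetEquality using (∼bag⇒↭)
open import Data.List.Relation.Binary.Permutation.Propositional using (_↭_; ↭⇒↭ₛ)
open import Data.List.Relation.Binary.Permutation.Propositional.Properties using (↭-length)
open import Data.List.Relation.Binary.Permutation.Setoid.Properties using (foldr-commMonoid)

open import Algebra.Bundles using (CommutativeRing)
import Algebra.Properties.CommutativeSemigroup as CommutativeSemigroupProperties
import Algebra.Properties.Group as GroupProperties
import Algebra.Properties.Semiring.Exp as SemiringExp
import Algebra.Properties.Semiring.Mult as SemiringMult
import Algebra.Properties.Semiring.Sum as SemiringSum
import Algebra.Properties.CommutativeSemiring.Exp as CommutativeSemiringExp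
import Algebra.Properties.CommutativeSemiring.Binomial as BinomialTheorem

module ℕ+ = CommutativeSemigroupProperties ℕP.+-commutativeSemigroup

module _ {A : Set} where

  sum-map-+ : ∀ (f g : A → ℕ) xs →
              sum (map (λ x → f x ℕ.+ g x) xs) ≡ sum (map f xs) ℕ.+ sum (map g xs)
  sum-map-+ f g [] = refl
  sum-map-+ f g (x ∷ xs) = trans (cong (f x ℕ.+ g x ℕ.+_) (sum-map-+ f g xs))
                                 (ℕ+.interchange (f x) (g x) _ _)

  sum-map-*ˡ : ∀ c (f : A → ℕ) xs → sum (map (λ x → c ℕ.* f x) xs) ≡ c ℕ.* sum (map f xs)
  sum-map-*ˡ c f [] = sym (ℕP.*-zeroʳ c)
  sum-map-*ˡ c f (x ∷ xs) = trans (cong (c ℕ.* f x ℕ.+_) (sum-map-*ˡ c f xs))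
                                  (sym (ℕP.*-distribˡ-+ c (f x) _))

  sum-map-mono : ∀ {f g : A → ℕ} → (∀ x → f x ≤ g x) → ∀ xs → sum (map f xs) ≤ sum (map g xs)
  sum-map-mono f≤g [] = z≤n
  sum-map-mono f≤g (x ∷ xs) = ℕP.+-mono-≤ (f≤g x) (sum-map-mono f≤g xs)

  sum-map-≤ : ∀ {f : A → ℕ} {c xs} → All (λ x → f x ≤ c) xs → sum (map f xs) ≤ length xs ℕ.* c
  sum-map-≤ [] = z≤n
  sum-map-≤ (fx≤c ∷ f≤c) = ℕP.+-mono-≤ fx≤c (sum-map-≤ f≤c)

  sum-map-< : ∀ {f : A → ℕ} {c xs} → All (λ x → f x ≤ c) xs → Any (λ x → f x < c) xs →
              sum (map f xs) < length xs ℕ.* c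
  sum-map-< (_ ∷ f≤c) (here fx<c) = ℕP.+-mono-<-≤ fx<c (sum-map-≤ f≤c)
  sum-map-< (fx≤c ∷ f≤c) (there any) = ℕP.+-mono-≤-< fx≤c (sum-map-< f≤c any)

module _ {A B : Set} where

  sum-map-swap : ∀ (f : A → B → ℕ) xs ys →
    sum (map (λ x → sum (map (f x) ys)) xs) ≡ sum (map (λ y → sum (map (λ x → f x y) xs)) ys)
  sum-map-swap f [] ys = sym (sum-map-*ˡ 0 (λ _ → 0) ys)  -- 0 ℕ.* x computes to 0
  sum-map-swap f (x ∷ xs) ys = trans (cong (sum (map (f x) ys) ℕ.+_) (sum-map-swap f xs ys))
                                     (sym (sum-map-+ (f x) (λ y → sum (map (λ x → f x y) xs)) ys))

module _ {A B D : Set} (f : A → B → D) where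
  open ≡-Reasoning

  length-cartesianProductWith : ∀ xs ys →
    length (cartesianProductWith f xs ys) ≡ length xs ℕ.* length ys
  length-cartesianProductWith [] ys = refl
  length-cartesianProductWith (x ∷ xs) ys = begin
    length (map (f x) ys ++ cartesianProductWith f xs ys)
      ≡⟨ ListP.length-++ (map (f x) ys) ⟩
    length (map (f x) ys) ℕ.+ length (cartesianProductWith f xs ys)
      ≡⟨ cong₂ ℕ._+_ (ListP.length-map (f x) ys) (length-cartesianProductWith xs ys) ⟩
    length ys ℕ.+ length xs ℕ.* length ys ∎

  sum-map-cartesianProductWith : ∀ (c : D → ℕ) xs ys →
    sum (map c (cartesianProductWith f xs ys)) ≡ sum (map (λ x → sum (map (λ y → c (f x y)) ys)) xs)
  sum-map-cartesianProductWith c [] ys = refl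
  sum-map-cartesianProductWith c (x ∷ xs) ys = begin
    sum (map c (map (f x) ys ++ cartesianProductWith f xs ys))
      ≡⟨ cong sum (ListP.map-++ c (map (f x) ys) _) ⟩
    sum (map c (map (f x) ys) ++ map c (cartesianProductWith f xs ys))
      ≡⟨ sum-++ (map c (map (f x) ys)) _ ⟩
    sum (map c (map (f x) ys)) ℕ.+ sum (map c (cartesianProductWith f xs ys))
      ≡⟨ cong₂ ℕ._+_ (cong sum (sym (ListP.map-∘ ys))) (sum-map-cartesianProductWith c xs ys) ⟩
    sum (map (λ y → c (f x y)) ys) ℕ.+ sum (map (λ x → sum (map (λ y → c (f x y)) ys)) xs) ∎

  module _ {P : Pred D 0ℓ} where

    All-cartesianProductWith⁺ : (∀ x y → P (f x y)) → ∀ xs ys → All P (cartesianProductWith f xs ys)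
    All-cartesianProductWith⁺ Pf [] ys = []
    All-cartesianProductWith⁺ Pf (x ∷ xs) ys =
      AllP.++⁺ (AllP.map⁺ (All.universal (Pf x) ys)) (All-cartesianProductWith⁺ Pf xs ys)

    All-cartesianProductWith⁻ : ∀ xs ys → All P (cartesianProductWith f xs ys) →
                                ∀ {x y} → x ∈ xs → y ∈ ys → P (f x y)
    All-cartesianProductWith⁻ (x ∷ xs) ys all (here refl) y∈ys =
      All.lookup (AllP.map⁻ (AllP.++⁻ˡ (map (f x) ys) all)) y∈ys
    All-cartesianProductWith⁻ (x ∷ xs) ys all (there x∈xs) y∈ys =
      All-cartesianProductWith⁻ xs ys (AllP.++⁻ʳ (map (f x) ys) all) x∈xs y∈ys

module _ {A : Set} {m} (f : Fin m → A) (k : Fin m) (v : A) where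

  setAt-self : setAt f k v k ≡ v
  setAt-self with k Fin.≟ k
  ... | yes _ = refl
  ... | no k≢k = ⊥-elim (k≢k refl)

  setAt-preserves : ∀ {P : Pred A 0ℓ} → P v → (∀ i → P (f i)) → ∀ i → P (setAt f k v i)
  setAt-preserves Pv Pf i with i Fin.≟ k
  ... | yes _ = Pv
  ... | no _ = Pf i

sieve-arithmetic : ∀ {a s t L} → s ≤ 1 → a ≤ L ℕ.* s → (s ≡ 1 → t ≡ 1 ⊎ a < L ℕ.* s) →
                   a ℕ.+ s ≤ t ℕ.+ L ℕ.* s
sieve-arithmetic {a} {zero} {t} {L} _ a≤0 _ = begin
  a ℕ.+ 0    ≡⟨ ℕP.+-identityʳ a ⟩
  a          ≤⟨ a≤0 ⟩
  L ℕ.* 0    ≤⟨ ℕP.m≤n+m _ t ⟩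
  t ℕ.+ L ℕ.* 0 ∎
  where
  open ℕP.≤-Reasoning
sieve-arithmetic {a} {suc zero} {t} {L} _ a≤L cases with cases refl
... | inj₁ refl = ℕP.≤-trans (ℕP.≤-reflexive (ℕP.+-comm a 1)) (s≤s a≤L)
... | inj₂ a<L = ℕP.≤-trans (ℕP.≤-reflexive (ℕP.+-comm a 1)) (ℕP.≤-trans a<L (ℕP.m≤n+m _ t))
sieve-arithmetic {s = suc (suc _)} (s≤s ()) _ _

module Counting {A : Set} (_≟_ : DecidableEquality A) (elems : List A)
                (elems-unique : Unique elems) (elems-complete : ∀ x → x ∈ elems) where
  open DecMembership _≟_ using (_∈?_)

  private variable
    P Q : Pred A 0ℓ
    c d : ℕ

  HasCard⇒Decidable : HasCard P c → Decidable P
  HasCard⇒Decidable (xs , _ , xs⇔P , _) x with x ∈? xs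
  ... | yes x∈xs = yes (Equivalence.to (xs⇔P x) x∈xs)
  ... | no x∉xs = no (λ Px → x∉xs (Equivalence.from (xs⇔P x) Px))

  indicator : HasCard P c → A → ℕ
  indicator hP x with HasCard⇒Decidable hP x
  ... | yes _ = 1
  ... | no _ = 0

  indicator≤1 : (hP : HasCard P c) → ∀ x → indicator hP x ≤ 1
  indicator≤1 hP x with HasCard⇒Decidable hP x
  ... | yes _ = s≤s z≤n
  ... | no _ = z≤n

  indicator-yes : (hP : HasCard P c) → ∀ {x} → P x → indicator hP x ≡ 1
  indicator-yes hP {x} Px with HasCard⇒Decidable hP x
  ... | yes _ = refl
  ... | no ¬Px = ⊥-elim (¬Px Px)

  indicator-no : (hP : HasCard P c) → ∀ {x} → ¬ P x → indicator hP x ≡ 0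
  indicator-no hP {x} ¬Px with HasCard⇒Decidable hP x
  ... | yes Px = ⊥-elim (¬Px Px)
  ... | no _ = refl

  indicator≡1⇒ : (hP : HasCard P c) → ∀ {x} → indicator hP x ≡ 1 → P x
  indicator≡1⇒ hP {x} eq with HasCard⇒Decidable hP x
  indicator≡1⇒ hP {x} refl | yes Px = Px

  indicator-mono : (hP : HasCard P c) (hQ : HasCard Q d) → P ⊆ Q → ∀ x → indicator hP x ≤ indicator hQ x
  indicator-mono hP hQ P⊆Q x with HasCard⇒Decidable hP x | HasCard⇒Decidable hQ x
  ... | yes _ | yes _ = s≤s z≤n
  ... | yes Px | no ¬Qx = ⊥-elim (¬Qx (P⊆Q Px))
  ... | no _ | _ = z≤n

  sum-indicator≡length-filter : (hP : HasCard P c) → ∀ xs →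
    sum (map (indicator hP) xs) ≡ length (filter (HasCard⇒Decidable hP) xs)
  sum-indicator≡length-filter hP [] = refl
  sum-indicator≡length-filter hP (x ∷ xs) with HasCard⇒Decidable hP x
  ... | yes _ = cong suc (sum-indicator≡length-filter hP xs)
  ... | no _ = sum-indicator≡length-filter hP xs

  card≡sum-indicator : (hP : HasCard P c) → c ≡ sum (map (indicator hP) elems)
  card≡sum-indicator {P = P} hP@(xs , xs-unique , xs⇔P , refl) = begin
    length xs                 ≡⟨ ↭-length xs↭filter ⟩
    length (filter P? elems)  ≡⟨ sum-indicator≡length-filter hP elems ⟨
    sum (map (indicator hP) elems) ∎
    where
    open ≡-Reasoning
    P? : Decidable P
    P? = HasCard⇒Decidable hP
    xs↭filter : xs ↭ filter P? elems
    xs↭filter = ∼bag⇒↭ (unique∧set⇒bag xs-unique (UniqueP.filter⁺ P? elems-unique) λ {x} → mk⇔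
      (λ x∈xs → ∈-filter⁺ P? (elems-complete x) (Equivalence.to (xs⇔P x) x∈xs))
      (λ x∈filter → Equivalence.from (xs⇔P x) (proj₂ (∈-filter⁻ P? {xs = elems} x∈filter))))

  module _ {I : Set} {S T : Pred A 0ℓ} {P : I → Pred A 0ℓ} {s t : ℕ} {c : I → ℕ}
           (hS : HasCard S s) (hT : HasCard T t) (hP : ∀ i → HasCard (P i) (c i)) {is : List I}
           (P⊆S : All (λ i → P i ⊆ S) is) (S∩⋂P⊆T : ∀ {x} → S x → All (λ i → P i x) is → T x) where

    -- A point of S outside T misses some P i, which pays for its extra count on the left.
    sieve-pointwise : ∀ x → sum (map (λ i → indicator (hP i) x) is) ℕ.+ indicator hS x
                            ≤ indicator hT x ℕ.+ length is ℕ.* indicator hS x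
    sieve-pointwise x =
      sieve-arithmetic {L = length is} (indicator≤1 hS x) (sum-map-≤ P≤S) (T⊎deficient (HasCard⇒Decidable hT x))
      where
      Σχ : ℕ
      Σχ = sum (map (λ i → indicator (hP i) x) is)
      P≤S : All (λ i → indicator (hP i) x ≤ indicator hS x) is
      P≤S = All.map (λ {i} Pi⊆S → indicator-mono (hP i) hS (λ {y} → Pi⊆S {y}) x) P⊆S
      T⊎deficient : Dec (T x) → indicator hS x ≡ 1 → indicator hT x ≡ 1 ⊎ Σχ < length is ℕ.* indicator hS x
      T⊎deficient (yes Tx) _ = inj₁ (indicator-yes hT Tx)
      T⊎deficient (no ¬Tx) χS≡1 = inj₂ (subst (λ k → Σχ < length is ℕ.* k) (sym χS≡1)
        (sum-map-< (All.universal (λ i → indicator≤1 (hP i) x) is) some-P-fails))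
        where
        some-P-fails : Any (λ i → indicator (hP i) x < 1) is
        some-P-fails = Any.map (λ ¬Pix → ℕP.≤-reflexive (cong suc (indicator-no (hP _) ¬Pix)))
          (¬All⇒Any¬ (λ i → HasCard⇒Decidable (hP i) x) is (¬Tx ∘ S∩⋂P⊆T (indicator≡1⇒ hS χS≡1)))

    sieve : sum (map c is) ℕ.+ s ≤ t ℕ.+ length is ℕ.* s
    sieve = begin
      sum (map c is) ℕ.+ s
        ≡⟨ cong₂ ℕ._+_ (cong sum (ListP.map-cong (λ i → card≡sum-indicator (hP i)) is))
                       (card≡sum-indicator hS) ⟩
      sum (map (λ i → sum (map χ[ i ] elems)) is) ℕ.+ sum (map χS elems)
        ≡⟨ cong (ℕ._+ sum (map χS elems)) (sum-map-swap (λ i → χ[ i ]) is elems) ⟩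
      sum (map (λ x → sum (map (λ i → χ[ i ] x) is)) elems) ℕ.+ sum (map χS elems)
        ≡⟨ sum-map-+ (λ x → sum (map (λ i → χ[ i ] x) is)) χS elems ⟨
      sum (map (λ x → sum (map (λ i → χ[ i ] x) is) ℕ.+ χS x) elems)
        ≤⟨ sum-map-mono sieve-pointwise elems ⟩
      sum (map (λ x → χT x ℕ.+ length is ℕ.* χS x) elems)
        ≡⟨ sum-map-+ χT (λ x → length is ℕ.* χS x) elems ⟩
      sum (map χT elems) ℕ.+ sum (map (λ x → length is ℕ.* χS x) elems)
        ≡⟨ cong (sum (map χT elems) ℕ.+_) (sum-map-*ˡ (length is) χS elems) ⟩
      sum (map χT elems) ℕ.+ length is ℕ.* sum (map χS elems)
        ≡⟨ cong₂ (λ u v → u ℕ.+ length is ℕ.* v) (card≡sum-indicator hT) (card≡sum-indicator hS) ⟨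
      t ℕ.+ length is ℕ.* s ∎
      where
      open ℕP.≤-Reasoning
      χ[_] : I → A → ℕ
      χ[ i ] = indicator (hP i)
      χS χT : A → ℕ
      χS = indicator hS
      χT = indicator hT

prime∤m! : ∀ {p} → Prime p → ∀ {m} → m < p → ¬ p ∣ m !
prime∤m! p-prime {zero} _ p∣1 = ¬prime[1] (subst Prime (∣1⇒≡1 p∣1) p-prime)
prime∤m! p-prime {suc m} 1+m<p p∣[1+m]! with euclidsLemma (suc m) (m !) p-prime p∣[1+m]!
... | inj₁ p∣1+m = ℕP.<⇒≱ 1+m<p (∣⇒≤ p∣1+m)
... | inj₂ p∣m! = prime∤m! p-prime (ℕP.<-trans (ℕP.n<1+n m) 1+m<p) p∣m!

prime∣pCk : ∀ {p k} → Prime p → 0 < k → k < p → p ∣ p C k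
prime∣pCk {p@(suc p-1)} {k} p-prime 0<k k<p
  with euclidsLemma (p C k) (k ! ℕ.* (p ∸ k) !) p-prime p∣pCk*k!*[p∸k]!
  where
  instance _ = k !* (p ∸ k) !≢0
  p∣pCk*k!*[p∸k]! : p ∣ (p C k) ℕ.* (k ! ℕ.* (p ∸ k) !)
  p∣pCk*k!*[p∸k]! = subst (p ∣_)
    (sym (trans (cong (ℕ._* (k ! ℕ.* (p ∸ k) !)) (nCk≡n!/k![n-k]! (ℕP.<⇒≤ k<p)))
                (m/n*n≡m (k![n∸k]!∣n! (ℕP.<⇒≤ k<p)))))
    (m∣m*n (p-1 !))
... | inj₁ p∣pCk = p∣pCk
... | inj₂ p∣k!*[p∸k]! with euclidsLemma (k !) ((p ∸ k) !) p-prime p∣k!*[p∸k]!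
...   | inj₁ p∣k! = ⊥-elim (prime∤m! p-prime k<p p∣k!)
...   | inj₂ p∣[p∸k]! = ⊥-elim (prime∤m! p-prime (ℕP.∸-monoʳ-< 0<k (ℕP.<⇒≤ k<p)) p∣[p∸k]!)

prime-divisor : ∀ {d} → d ≢ 0 → d ≢ 1 → ∃[ p ] (Prime p × p ∣ d)
prime-divisor {zero} d≢0 _ = ⊥-elim (d≢0 refl)
prime-divisor {d@(suc _)} _ d≢1 with factorise d
... | record { factors = [] ; isFactorisation = d≡1 } = ⊥-elim (d≢1 d≡1)
... | record { factors = p ∷ _ ; isFactorisation = d≡p*ps ; factorsPrime = p-prime ∷ _ } =
  p , p-prime , subst (p ∣_) (sym d≡p*ps) (m∣m*n _)

prime-power∸1≢0 : ∀ {p e} → Prime p → 1 ≤ e → p ℕ.^ e ∸ 1 ≢ 0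
prime-power∸1≢0 {p} {e} p-prime 1≤e pᵉ∸1≡0 =
  ℕP.<⇒≱ (ℕP.<-≤-trans (nonTrivial⇒n>1 p) p≤pᵉ) (ℕP.m∸n≡0⇒m≤n pᵉ∸1≡0)
  where
  instance
    _ = prime⇒nonTrivial p-prime
    _ = prime⇒nonZero p-prime
  p≤pᵉ : p ≤ p ℕ.^ e
  p≤pᵉ = subst (_≤ p ℕ.^ e) (ℕP.*-identityʳ p) (ℕP.^-monoʳ-≤ p 1≤e)

FrobeniusAdditive : FiniteField → ℕ → Set
FrobeniusAdditive F q = ∀ a b → (a + b) ^ q ≡ a ^ q + b ^ q
  where
  open FiniteField F
  open FieldDefs F q

module FieldArithmetic (F : FiniteField) (q : ℕ) where
  open FiniteField F
  open FieldDefs F q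

  commutativeRing : CommutativeRing 0ℓ 0ℓ
  commutativeRing = record { isCommutativeRing = isCommutativeRing }

  open CommutativeRing commutativeRing public
    using ( +-comm; +-identityˡ; +-identityʳ; *-assoc; *-comm; *-identityˡ; *-identityʳ; zeroˡ; zeroʳ
          ; semiring; commutativeSemiring; +-group; +-isCommutativeMonoid )

  private
    module Exp = SemiringExp semiring
    module Mult = SemiringMult semiring
    module +-Group = GroupProperties +-group
    module Binomial = BinomialTheorem commutativeSemiring
    module Sum = SemiringSum semiring
  open ≡-Reasoning

  ^≡Exp^ : ∀ x n → x ^ n ≡ x Exp.^ n
  ^≡Exp^ x zero = refl
  ^≡Exp^ x (suc n) = cong (x *_) (^≡Exp^ x n)

  ·≡× : ∀ n x → n · x ≡ n Mult.× x
  ·≡× zero x = refl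
  ·≡× (suc n) x = cong (x +_) (·≡× n x)

  ^-*-assoc : ∀ x m n → (x ^ m) ^ n ≡ x ^ (m ℕ.* n)
  ^-*-assoc x m n = begin
    (x ^ m) ^ n             ≡⟨ ^≡Exp^ (x ^ m) n ⟩
    (x ^ m) Exp.^ n         ≡⟨ cong (Exp._^ n) (^≡Exp^ x m) ⟩
    (x Exp.^ m) Exp.^ n     ≡⟨ Exp.^-assocʳ x m n ⟩
    x Exp.^ (m ℕ.* n)       ≡⟨ ^≡Exp^ x (m ℕ.* n) ⟨
    x ^ (m ℕ.* n)           ∎

  ^-distrib-* : ∀ x y n → (x * y) ^ n ≡ x ^ n * y ^ n
  ^-distrib-* x y n = begin
    (x * y) ^ n             ≡⟨ ^≡Exp^ (x * y) n ⟩
    (x * y) Exp.^ n         ≡⟨ CommutativeSemiringExp.^-distrib-* commutativeSemiring x y n ⟩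
    x Exp.^ n * y Exp.^ n   ≡⟨ cong₂ _*_ (^≡Exp^ x n) (^≡Exp^ y n) ⟨
    x ^ n * y ^ n           ∎

  1^n≡1 : ∀ n → 1# ^ n ≡ 1#
  1^n≡1 zero = refl
  1^n≡1 (suc n) = trans (*-identityˡ _) (1^n≡1 n)

  ·≡·1* : ∀ n x → n · x ≡ (n · 1#) * x
  ·≡·1* n x = begin
    n · x                   ≡⟨ ·≡× n x ⟩
    n Mult.× x              ≡⟨ cong (n Mult.×_) (*-identityˡ x) ⟨
    n Mult.× (1# * x)       ≡⟨ Mult.×-assoc-* n 1# x ⟨
    (n Mult.× 1#) * x       ≡⟨ cong (_* x) (·≡× n 1#) ⟨
    (n · 1#) * x            ∎

  ·1-homo-* : ∀ m n → (m ℕ.* n) · 1# ≡ (m · 1#) * (n · 1#)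
  ·1-homo-* m n = begin
    (m ℕ.* n) · 1#              ≡⟨ ·≡× (m ℕ.* n) 1# ⟩
    (m ℕ.* n) Mult.× 1#         ≡⟨ Mult.×1-homo-* m n ⟩
    (m Mult.× 1#) * (n Mult.× 1#) ≡⟨ cong₂ _*_ (·≡× m 1#) (·≡× n 1#) ⟨
    (m · 1#) * (n · 1#)         ∎

  ·1-homo-^ : ∀ m n → (m ℕ.^ n) · 1# ≡ (m · 1#) ^ n
  ·1-homo-^ m zero = +-identityʳ 1#
  ·1-homo-^ m (suc n) = trans (·1-homo-* m (m ℕ.^ n)) (cong ((m · 1#) *_) (·1-homo-^ m n))

  x*y≡0⇒x≡0∨y≡0 : ∀ x y → x * y ≡ 0# → x ≡ 0# ⊎ y ≡ 0#
  x*y≡0⇒x≡0∨y≡0 x y xy≡0 with x ≟ 0#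
  ... | yes x≡0 = inj₁ x≡0
  ... | no x≢0 = let (x⁻¹ , xx⁻¹≡1) = inverse x x≢0 in inj₂ (begin
    y                 ≡⟨ *-identityˡ y ⟨
    1# * y            ≡⟨ cong (_* y) xx⁻¹≡1 ⟨
    (x * x⁻¹) * y     ≡⟨ cong (_* y) (*-comm x x⁻¹) ⟩
    (x⁻¹ * x) * y     ≡⟨ *-assoc x⁻¹ x y ⟩
    x⁻¹ * (x * y)     ≡⟨ cong (x⁻¹ *_) xy≡0 ⟩
    x⁻¹ * 0#          ≡⟨ zeroʳ x⁻¹ ⟩
    0#                ∎)

  xⁿ≡0⇒x≡0 : ∀ x n → x ^ n ≡ 0# → x ≡ 0#
  xⁿ≡0⇒x≡0 x zero 1≡0 = ⊥-elim (0≢1 (sym 1≡0))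
  xⁿ≡0⇒x≡0 x (suc n) xxⁿ≡0 with x*y≡0⇒x≡0∨y≡0 x (x ^ n) xxⁿ≡0
  ... | inj₁ x≡0 = x≡0
  ... | inj₂ xⁿ≡0 = xⁿ≡0⇒x≡0 x n xⁿ≡0

  ΣK : List K → K
  ΣK = List.foldr _+_ 0#

  ΣK-↭ : ∀ {xs ys} → xs ↭ ys → ΣK xs ≡ ΣK ys
  ΣK-↭ xs↭ys = foldr-commMonoid (≡.setoid K) +-isCommutativeMonoid (↭⇒↭ₛ xs↭ys)

  ΣK-map-+1 : ∀ xs → ΣK (map (_+ 1#) xs) ≡ ΣK xs + length xs · 1#
  ΣK-map-+1 [] = sym (+-identityˡ 0#)
  ΣK-map-+1 (x ∷ xs) = begin
    (x + 1#) + ΣK (map (_+ 1#) xs)    ≡⟨ cong ((x + 1#) +_) (ΣK-map-+1 xs) ⟩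
    (x + 1#) + (ΣK xs + length xs · 1#) ≡⟨ K+.interchange x 1# (ΣK xs) (length xs · 1#) ⟩
    (x + ΣK xs) + (1# + length xs · 1#) ∎
    where
    module K+ = CommutativeSemigroupProperties (CommutativeRing.+-commutativeSemigroup commutativeRing)

  -- Translation by 1 permutes the field, so Σ x = Σ (x + 1) = Σ x + card · 1.
  card·1≡0 : card · 1# ≡ 0#
  card·1≡0 = +-Group.identityʳ-unique (ΣK elems) (card · 1#) (sym (begin
    ΣK elems                  ≡⟨ ΣK-↭ translate-elems ⟨
    ΣK (map (_+ 1#) elems)    ≡⟨ ΣK-map-+1 elems ⟩
    ΣK elems + card · 1#      ∎))
    where
    translate-elems : map (_+ 1#) elems ↭ elems
    translate-elems = ∼bag⇒↭ (unique∧set⇒bag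
      (UniqueP.map⁺ (+-Group.∙-cancelʳ 1# _ _) elems-unique) elems-unique λ {x} → mk⇔
        (λ _ → elems-complete x)
        (λ _ → subst (_∈ map (_+ 1#) elems) (+-Group.//-rightDividesˡ 1# x)
                 (∈-map⁺ (_+ 1#) (elems-complete (x + - 1#)))))

  card≡pᵉ⇒p·1≡0 : ∀ {p e} → card ≡ p ℕ.^ e → p · 1# ≡ 0#
  card≡pᵉ⇒p·1≡0 {p} {e} card≡pᵉ = xⁿ≡0⇒x≡0 (p · 1#) e (begin
    (p · 1#) ^ e     ≡⟨ ·1-homo-^ p e ⟨
    (p ℕ.^ e) · 1#   ≡⟨ cong (_· 1#) card≡pᵉ ⟨
    card · 1#        ≡⟨ card·1≡0 ⟩
    0#               ∎)

  p·1≡0⇒[m*p]·x≡0 : ∀ {p} → p · 1# ≡ 0# → ∀ m x → (m ℕ.* p) · x ≡ 0#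
  p·1≡0⇒[m*p]·x≡0 {p} p·1≡0 m x = begin
    (m ℕ.* p) · x               ≡⟨ ·≡·1* (m ℕ.* p) x ⟩
    ((m ℕ.* p) · 1#) * x        ≡⟨ cong (_* x) (·1-homo-* m p) ⟩
    ((m · 1#) * (p · 1#)) * x   ≡⟨ cong (λ z → ((m · 1#) * z) * x) p·1≡0 ⟩
    ((m · 1#) * 0#) * x         ≡⟨ cong (_* x) (zeroʳ (m · 1#)) ⟩
    0# * x                      ≡⟨ zeroˡ x ⟩
    0#                          ∎

  additive-if-inner-binomialTerms≡0 : ∀ n a b →
    (∀ (i : Fin n) → Binomial.binomialTerm a b (suc n) (Fin.suc (inject₁ i)) ≡ 0#) →
    (a + b) ^ suc n ≡ a ^ suc n + b ^ suc n
  additive-if-inner-binomialTerms≡0 n a b inner≡0 = begin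
    (a + b) ^ suc n
      ≡⟨ ^≡Exp^ (a + b) (suc n) ⟩
    (a + b) Exp.^ suc n
      ≡⟨ Binomial.theorem (suc n) a b ⟩
    t Fin.zero + Sum.sum (λ i → t (Fin.suc i))
      ≡⟨ cong (t Fin.zero +_) (Sum.sum-init-last (λ i → t (Fin.suc i))) ⟩
    t Fin.zero + (Sum.sum (λ i → t (Fin.suc (inject₁ i))) + t (Fin.suc (fromℕ n)))
      ≡⟨ cong (λ z → t Fin.zero + (z + t (Fin.suc (fromℕ n))))
              (trans (Sum.sum-cong-≗ inner≡0) (Sum.sum-replicate-zero n)) ⟩
    t Fin.zero + (0# + t (Fin.suc (fromℕ n)))
      ≡⟨ cong₂ (λ u v → u + (0# + v)) first last ⟩
    b ^ suc n + (0# + a ^ suc n)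
      ≡⟨ trans (cong (b ^ suc n +_) (+-identityˡ _)) (+-comm _ _) ⟩
    a ^ suc n + b ^ suc n ∎
    where
    t : Fin (suc (suc n)) → K
    t = Binomial.binomialTerm a b (suc n)
    first : t Fin.zero ≡ b ^ suc n
    first = trans (+-identityʳ _) (trans (*-identityˡ _) (sym (^≡Exp^ b (suc n))))
    last : t (Fin.suc (fromℕ n)) ≡ a ^ suc n
    last rewrite FinP.toℕ-fromℕ n | nCn≡1 (suc n) | ℕP.n∸n≡0 n =
      trans (+-identityʳ _) (trans (*-identityʳ _) (sym (^≡Exp^ a (suc n))))

  frobenius-prime : ∀ {p} → Prime p → p · 1# ≡ 0# → ∀ a b → (a + b) ^ p ≡ a ^ p + b ^ p
  frobenius-prime {suc n} p-prime p·1≡0 a b = additive-if-inner-binomialTerms≡0 n a b inner≡0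
    where
    inner≡0 : ∀ (i : Fin n) → Binomial.binomialTerm a b (suc n) (Fin.suc (inject₁ i)) ≡ 0#
    inner≡0 i
      with prime∣pCk p-prime (s≤s z≤n) (s≤s (subst (ℕ._< n) (sym (FinP.toℕ-inject₁ i)) (FinP.toℕ<n i)))
    ... | divides m pCi≡m*p = begin
      (suc n C k) Mult.× term   ≡⟨ ·≡× (suc n C k) term ⟨
      (suc n C k) · term        ≡⟨ cong (_· term) pCi≡m*p ⟩
      (m ℕ.* suc n) · term      ≡⟨ p·1≡0⇒[m*p]·x≡0 p·1≡0 m term ⟩
      0#                        ∎
      where
      k : ℕ
      k = toℕ (Fin.suc (inject₁ i))
      term : K
      term = Binomial.binomial a b (suc n) (Fin.suc (inject₁ i))

  frobenius : ∀ {p} → Prime p → p · 1# ≡ 0# → ∀ k a b →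
              (a + b) ^ (p ℕ.^ k) ≡ a ^ (p ℕ.^ k) + b ^ (p ℕ.^ k)
  frobenius p-prime p·1≡0 zero a b =
    trans (*-identityʳ _) (cong₂ _+_ (sym (*-identityʳ a)) (sym (*-identityʳ b)))
  frobenius {p} p-prime p·1≡0 (suc k) a b = begin
    (a + b) ^ (p ℕ.* p ℕ.^ k)            ≡⟨ ^-*-assoc (a + b) p (p ℕ.^ k) ⟨
    ((a + b) ^ p) ^ (p ℕ.^ k)            ≡⟨ cong (_^ (p ℕ.^ k)) (frobenius-prime p-prime p·1≡0 a b) ⟩
    (a ^ p + b ^ p) ^ (p ℕ.^ k)          ≡⟨ frobenius p-prime p·1≡0 k (a ^ p) (b ^ p) ⟩
    (a ^ p) ^ (p ℕ.^ k) + (b ^ p) ^ (p ℕ.^ k)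
      ≡⟨ cong₂ _+_ (^-*-assoc a p (p ℕ.^ k)) (^-*-assoc b p (p ℕ.^ k)) ⟩
    a ^ (p ℕ.* p ℕ.^ k) + b ^ (p ℕ.* p ℕ.^ k) ∎

  frobenius-additive : ∀ {p k n} → Prime p → q ≡ p ℕ.^ k → card ≡ q ℕ.^ n → FrobeniusAdditive F q
  frobenius-additive {p} {k} {n} p-prime q≡pᵏ card≡qⁿ a b =
    subst (λ t → (a + b) ^ t ≡ a ^ t + b ^ t) (sym q≡pᵏ) (frobenius p-prime p·1≡0 k a b)
    where
    card≡pᵏⁿ : card ≡ p ℕ.^ (k ℕ.* n)
    card≡pᵏⁿ = trans card≡qⁿ (trans (cong (ℕ._^ n) q≡pᵏ) (ℕP.^-*-assoc p k n))
    p·1≡0 : p · 1# ≡ 0#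
    p·1≡0 = card≡pᵉ⇒p·1≡0 {e = k ℕ.* n} card≡pᵏⁿ

module Polynomials (F : FiniteField) (q : ℕ) where
  open FiniteField F
  open FieldDefs F q
  open FieldArithmetic F q
    using (commutativeSemiring; +-identityˡ; +-identityʳ; *-assoc; *-comm; *-identityˡ; zeroˡ; zeroʳ)
  open import Algebra.Solver.Ring.NaturalCoefficients.Default commutativeSemiring
  open ≡-Reasoning

  scale : K → Poly → Poly
  scale c = map (c *_)

  coeff : Poly → ℕ → K
  coeff [] i = 0#
  coeff (a ∷ f) zero = a
  coeff (a ∷ f) (suc i) = coeff f i

  -- Ring laws for _*ₚ_ hold only coefficientwise, since products with [] leave trailing zeros;
  -- ≈∧length⇒≡ turns them back into equations between lists.
  infix 4 _≈ₚ_
  record _≈ₚ_ (f g : Poly) : Set where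
    constructor mk≈
    field coeff-≡ : ∀ i → coeff f i ≡ coeff g i
  open _≈ₚ_

  ≈-refl : ∀ {f} → f ≈ₚ f
  ≈-refl = mk≈ λ i → refl

  ≈-sym : ∀ {f g} → f ≈ₚ g → g ≈ₚ f
  ≈-sym f≈g = mk≈ λ i → sym (coeff-≡ f≈g i)

  ≈-trans : ∀ {f g h} → f ≈ₚ g → g ≈ₚ h → f ≈ₚ h
  ≈-trans f≈g g≈h = mk≈ λ i → trans (coeff-≡ f≈g i) (coeff-≡ g≈h i)

  ≈ₚ-setoid : Setoid 0ℓ 0ℓ
  ≈ₚ-setoid = record { Carrier = Poly ; _≈_ = _≈ₚ_
                     ; isEquivalence = record { refl = ≈-refl ; sym = ≈-sym ; trans = ≈-trans } }

  ≡⇒≈ : ∀ {f g} → f ≡ g → f ≈ₚ g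
  ≡⇒≈ refl = ≈-refl

  ∷-cong : ∀ {a b f g} → a ≡ b → f ≈ₚ g → a ∷ f ≈ₚ b ∷ g
  ∷-cong a≡b f≈g = mk≈ λ { zero → a≡b ; (suc i) → coeff-≡ f≈g i }

  ∷-injectiveʳ : ∀ {a b f g} → a ∷ f ≈ₚ b ∷ g → f ≈ₚ g
  ∷-injectiveʳ a∷f≈b∷g = mk≈ λ i → coeff-≡ a∷f≈b∷g (suc i)

  0∷≈[] : ∀ {f} → f ≈ₚ [] → 0# ∷ f ≈ₚ []
  0∷≈[] f≈0 = mk≈ λ { zero → refl ; (suc i) → coeff-≡ f≈0 i }

  ∷≈[]⇒ : ∀ {a f} → a ∷ f ≈ₚ [] → f ≈ₚ []
  ∷≈[]⇒ a∷f≈0 = mk≈ λ i → coeff-≡ a∷f≈0 (suc i)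

  coeff-+ₚ : ∀ f g i → coeff (f +ₚ g) i ≡ coeff f i + coeff g i
  coeff-+ₚ [] g i = sym (+-identityˡ _)
  coeff-+ₚ (a ∷ f) [] i = sym (+-identityʳ _)
  coeff-+ₚ (a ∷ f) (b ∷ g) zero = refl
  coeff-+ₚ (a ∷ f) (b ∷ g) (suc i) = coeff-+ₚ f g i

  coeff-scale : ∀ c f i → coeff (scale c f) i ≡ c * coeff f i
  coeff-scale c [] i = sym (zeroʳ c)
  coeff-scale c (a ∷ f) zero = refl
  coeff-scale c (a ∷ f) (suc i) = coeff-scale c f i

  coeff-*ₚ : ∀ a f g i → coeff ((a ∷ f) *ₚ g) i ≡ a * coeff g i + coeff (0# ∷ (f *ₚ g)) i
  coeff-*ₚ a f g i = trans (coeff-+ₚ (scale a g) _ i) (cong (_+ _) (coeff-scale a g i))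

  +ₚ-cong : ∀ {f f′ g g′} → f ≈ₚ f′ → g ≈ₚ g′ → f +ₚ g ≈ₚ f′ +ₚ g′
  +ₚ-cong {f} {f′} {g} {g′} f≈f′ g≈g′ = mk≈ λ i → begin
    coeff (f +ₚ g) i              ≡⟨ coeff-+ₚ f g i ⟩
    coeff f i + coeff g i         ≡⟨ cong₂ _+_ (coeff-≡ f≈f′ i) (coeff-≡ g≈g′ i) ⟩
    coeff f′ i + coeff g′ i       ≡⟨ coeff-+ₚ f′ g′ i ⟨
    coeff (f′ +ₚ g′) i            ∎

  scale-cong : ∀ c {f g} → f ≈ₚ g → scale c f ≈ₚ scale c g
  scale-cong c {f} {g} f≈g = mk≈ λ i → begin
    coeff (scale c f) i   ≡⟨ coeff-scale c f i ⟩
    c * coeff f i         ≡⟨ cong (c *_) (coeff-≡ f≈g i) ⟩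
    c * coeff g i         ≡⟨ coeff-scale c g i ⟨
    coeff (scale c g) i   ∎

  *ₚ-zeroʳ : ∀ f → f *ₚ [] ≈ₚ []
  *ₚ-zeroʳ [] = ≈-refl
  *ₚ-zeroʳ (a ∷ f) = 0∷≈[] (*ₚ-zeroʳ f)

  *ₚ-zeroˡ : ∀ {f} g → f ≈ₚ [] → f *ₚ g ≈ₚ []
  *ₚ-zeroˡ {[]} g f≈0 = ≈-refl
  *ₚ-zeroˡ {a ∷ f} g a∷f≈0 = mk≈ λ i → begin
    coeff ((a ∷ f) *ₚ g) i                 ≡⟨ coeff-*ₚ a f g i ⟩
    a * coeff g i + coeff (0# ∷ (f *ₚ g)) i ≡⟨ cong₂ (λ u v → u * coeff g i + v)
                                                  (coeff-≡ a∷f≈0 zero)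
                                                  (coeff-≡ (0∷≈[] (*ₚ-zeroˡ g (∷≈[]⇒ a∷f≈0))) i) ⟩
    0# * coeff g i + 0#                     ≡⟨ trans (+-identityʳ _) (zeroˡ _) ⟩
    0#                                      ∎

  *ₚ-congˡ : ∀ {f f′} g → f ≈ₚ f′ → f *ₚ g ≈ₚ f′ *ₚ g
  *ₚ-congˡ {[]} {[]} g _ = ≈-refl
  *ₚ-congˡ {[]} {a′ ∷ f′} g 0≈f′ = ≈-sym (*ₚ-zeroˡ g (≈-sym 0≈f′))
  *ₚ-congˡ {a ∷ f} {[]} g f≈0 = *ₚ-zeroˡ g f≈0
  *ₚ-congˡ {a ∷ f} {a′ ∷ f′} g f≈f′ =
    +ₚ-cong (≡⇒≈ (cong (λ c → scale c g) (coeff-≡ f≈f′ zero)))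
            (∷-cong refl (*ₚ-congˡ g (∷-injectiveʳ f≈f′)))

  *ₚ-congʳ : ∀ f {g g′} → g ≈ₚ g′ → f *ₚ g ≈ₚ f *ₚ g′
  *ₚ-congʳ [] g≈g′ = ≈-refl
  *ₚ-congʳ (a ∷ f) g≈g′ = +ₚ-cong (scale-cong a g≈g′) (∷-cong refl (*ₚ-congʳ f g≈g′))

  *ₚ-distribʳ-+ₚ : ∀ f g h → (f +ₚ g) *ₚ h ≈ₚ (f *ₚ h) +ₚ (g *ₚ h)
  *ₚ-distribʳ-+ₚ [] g h = ≈-refl
  *ₚ-distribʳ-+ₚ (a ∷ f) [] h = mk≈ λ i → sym (trans (coeff-+ₚ ((a ∷ f) *ₚ h) [] i) (+-identityʳ _))
  *ₚ-distribʳ-+ₚ (a ∷ f) (b ∷ g) h = mk≈ λ i → begin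
    coeff (((a + b) ∷ (f +ₚ g)) *ₚ h) i
      ≡⟨ coeff-*ₚ (a + b) (f +ₚ g) h i ⟩
    (a + b) * coeff h i + coeff (0# ∷ ((f +ₚ g) *ₚ h)) i
      ≡⟨ cong ((a + b) * coeff h i +_) (shifted i) ⟩
    (a + b) * coeff h i + (coeff (0# ∷ (f *ₚ h)) i + coeff (0# ∷ (g *ₚ h)) i)
      ≡⟨ solve 5 (λ a b x u v → (a :+ b) :* x :+ (u :+ v) := (a :* x :+ u) :+ (b :* x :+ v))
               refl a b (coeff h i) _ _ ⟩
    (a * coeff h i + coeff (0# ∷ (f *ₚ h)) i) + (b * coeff h i + coeff (0# ∷ (g *ₚ h)) i)
      ≡⟨ cong₂ _+_ (coeff-*ₚ a f h i) (coeff-*ₚ b g h i) ⟨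
    coeff ((a ∷ f) *ₚ h) i + coeff ((b ∷ g) *ₚ h) i
      ≡⟨ coeff-+ₚ ((a ∷ f) *ₚ h) ((b ∷ g) *ₚ h) i ⟨
    coeff (((a ∷ f) *ₚ h) +ₚ ((b ∷ g) *ₚ h)) i ∎
    where
    shifted : ∀ i → coeff (0# ∷ ((f +ₚ g) *ₚ h)) i ≡ coeff (0# ∷ (f *ₚ h)) i + coeff (0# ∷ (g *ₚ h)) i
    shifted zero = sym (+-identityʳ 0#)
    shifted (suc i) = trans (coeff-≡ (*ₚ-distribʳ-+ₚ f g h) i) (coeff-+ₚ (f *ₚ h) (g *ₚ h) i)

  *ₚ-distribˡ-+ₚ : ∀ f g h → f *ₚ (g +ₚ h) ≈ₚ (f *ₚ g) +ₚ (f *ₚ h)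
  *ₚ-distribˡ-+ₚ [] g h = ≈-refl
  *ₚ-distribˡ-+ₚ (a ∷ f) g h = mk≈ λ i → begin
    coeff ((a ∷ f) *ₚ (g +ₚ h)) i
      ≡⟨ coeff-*ₚ a f (g +ₚ h) i ⟩
    a * coeff (g +ₚ h) i + coeff (0# ∷ (f *ₚ (g +ₚ h))) i
      ≡⟨ cong₂ (λ u v → a * u + v) (coeff-+ₚ g h i) (shifted i) ⟩
    a * (coeff g i + coeff h i) + (coeff (0# ∷ (f *ₚ g)) i + coeff (0# ∷ (f *ₚ h)) i)
      ≡⟨ solve 5 (λ a u v s t → a :* (u :+ v) :+ (s :+ t) := (a :* u :+ s) :+ (a :* v :+ t))
               refl a (coeff g i) (coeff h i) _ _ ⟩
    (a * coeff g i + coeff (0# ∷ (f *ₚ g)) i) + (a * coeff h i + coeff (0# ∷ (f *ₚ h)) i)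
      ≡⟨ cong₂ _+_ (coeff-*ₚ a f g i) (coeff-*ₚ a f h i) ⟨
    coeff ((a ∷ f) *ₚ g) i + coeff ((a ∷ f) *ₚ h) i
      ≡⟨ coeff-+ₚ ((a ∷ f) *ₚ g) ((a ∷ f) *ₚ h) i ⟨
    coeff (((a ∷ f) *ₚ g) +ₚ ((a ∷ f) *ₚ h)) i ∎
    where
    shifted : ∀ i → coeff (0# ∷ (f *ₚ (g +ₚ h))) i ≡ coeff (0# ∷ (f *ₚ g)) i + coeff (0# ∷ (f *ₚ h)) i
    shifted zero = sym (+-identityʳ 0#)
    shifted (suc i) = trans (coeff-≡ (*ₚ-distribˡ-+ₚ f g h) i) (coeff-+ₚ (f *ₚ g) (f *ₚ h) i)

  scale-*ₚ-≈ : ∀ c f g → scale c f *ₚ g ≈ₚ scale c (f *ₚ g)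
  scale-*ₚ-≈ c [] g = ≈-refl
  scale-*ₚ-≈ c (a ∷ f) g = mk≈ λ i → begin
    coeff ((c * a ∷ scale c f) *ₚ g) i
      ≡⟨ coeff-*ₚ (c * a) (scale c f) g i ⟩
    c * a * coeff g i + coeff (0# ∷ (scale c f *ₚ g)) i
      ≡⟨ cong (c * a * coeff g i +_) (shifted i) ⟩
    c * a * coeff g i + c * coeff (0# ∷ (f *ₚ g)) i
      ≡⟨ solve 4 (λ c a x y → c :* a :* x :+ c :* y := c :* (a :* x :+ y)) refl c a (coeff g i) _ ⟩
    c * (a * coeff g i + coeff (0# ∷ (f *ₚ g)) i)
      ≡⟨ cong (c *_) (coeff-*ₚ a f g i) ⟨
    c * coeff ((a ∷ f) *ₚ g) i
      ≡⟨ coeff-scale c ((a ∷ f) *ₚ g) i ⟨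
    coeff (scale c ((a ∷ f) *ₚ g)) i ∎
    where
    shifted : ∀ i → coeff (0# ∷ (scale c f *ₚ g)) i ≡ c * coeff (0# ∷ (f *ₚ g)) i
    shifted zero = sym (zeroʳ c)
    shifted (suc i) = trans (coeff-≡ (scale-*ₚ-≈ c f g) i) (coeff-scale c (f *ₚ g) i)

  0∷-*ₚ : ∀ f g → (0# ∷ f) *ₚ g ≈ₚ 0# ∷ (f *ₚ g)
  0∷-*ₚ f g = mk≈ λ i → trans (coeff-*ₚ 0# f g i)
    (trans (cong (_+ coeff (0# ∷ (f *ₚ g)) i) (zeroˡ (coeff g i))) (+-identityˡ _))

  *ₚ-0∷ : ∀ f g → f *ₚ (0# ∷ g) ≈ₚ 0# ∷ (f *ₚ g)
  *ₚ-0∷ [] g = mk≈ λ { zero → refl ; (suc i) → refl }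
  *ₚ-0∷ (a ∷ f) g = mk≈ λ
    { zero → trans (coeff-*ₚ a f (0# ∷ g) zero) (trans (+-identityʳ _) (zeroʳ a))
    ; (suc i) → trans (coeff-*ₚ a f (0# ∷ g) (suc i))
                      (trans (cong (a * coeff g i +_) (coeff-≡ (*ₚ-0∷ f g) i)) (sym (coeff-*ₚ a f g i))) }

  *ₚ-constant : ∀ f a → f *ₚ (a ∷ []) ≈ₚ scale a f
  *ₚ-constant [] a = ≈-refl
  *ₚ-constant (b ∷ f) a = mk≈ λ
    { zero → trans (coeff-*ₚ b f (a ∷ []) zero) (trans (+-identityʳ _) (*-comm b a))
    ; (suc i) → trans (coeff-*ₚ b f (a ∷ []) (suc i))
                      (trans (cong (_+ coeff (f *ₚ (a ∷ [])) i) (zeroʳ b))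
                             (trans (+-identityˡ _) (coeff-≡ (*ₚ-constant f a) i))) }

  *ₚ-comm-≈ : ∀ f g → f *ₚ g ≈ₚ g *ₚ f
  *ₚ-comm-≈ [] g = ≈-sym (*ₚ-zeroʳ g)
  *ₚ-comm-≈ (a ∷ f) g = ≈-sym (begin≈
    g *ₚ (a ∷ f)                          ≈⟨ *ₚ-congʳ g (∷-cong (sym (+-identityʳ a)) ≈-refl) ⟩
    g *ₚ ((a ∷ []) +ₚ (0# ∷ f))           ≈⟨ *ₚ-distribˡ-+ₚ g (a ∷ []) (0# ∷ f) ⟩
    (g *ₚ (a ∷ [])) +ₚ (g *ₚ (0# ∷ f))    ≈⟨ +ₚ-cong (*ₚ-constant g a)
                                               (≈-trans (*ₚ-0∷ g f) (∷-cong refl (*ₚ-comm-≈ g f))) ⟩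
    scale a g +ₚ (0# ∷ (f *ₚ g))          ∎≈)
    where
    open SetoidReasoning ≈ₚ-setoid renaming (begin_ to begin≈_; _∎ to _∎≈)

  *ₚ-assoc-≈ : ∀ f g h → (f *ₚ g) *ₚ h ≈ₚ f *ₚ (g *ₚ h)
  *ₚ-assoc-≈ [] g h = ≈-refl
  *ₚ-assoc-≈ (a ∷ f) g h =
    ≈-trans (*ₚ-distribʳ-+ₚ (scale a g) (0# ∷ (f *ₚ g)) h)
            (+ₚ-cong (scale-*ₚ-≈ a g h) (≈-trans (0∷-*ₚ (f *ₚ g) h) (∷-cong refl (*ₚ-assoc-≈ f g h))))

  length-scale : ∀ c f → length (scale c f) ≡ length f
  length-scale c = ListP.length-map (c *_)

  length-+ₚ : ∀ f g → length (f +ₚ g) ≡ length f ⊔ length g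
  length-+ₚ [] g = refl
  length-+ₚ (a ∷ f) [] = refl
  length-+ₚ (a ∷ f) (b ∷ g) = cong suc (length-+ₚ f g)

  length-*ₚ-cong : ∀ f f′ g g′ → length f ≡ length f′ → length g ≡ length g′ →
                   length (f *ₚ g) ≡ length (f′ *ₚ g′)
  length-*ₚ-cong [] [] g g′ _ _ = refl
  length-*ₚ-cong (a ∷ f) (a′ ∷ f′) g g′ |f|≡|f′| |g|≡|g′| = begin
    length (scale a g +ₚ (0# ∷ (f *ₚ g)))          ≡⟨ length-+ₚ (scale a g) _ ⟩
    length (scale a g) ⊔ suc (length (f *ₚ g))     ≡⟨ cong₂ (λ u v → u ⊔ suc v)
      (trans (length-scale a g) (trans |g|≡|g′| (sym (length-scale a′ g′))))
      (length-*ₚ-cong f f′ g g′ (ℕP.suc-injective |f|≡|f′|) |g|≡|g′|) ⟩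
    length (scale a′ g′) ⊔ suc (length (f′ *ₚ g′)) ≡⟨ length-+ₚ (scale a′ g′) _ ⟨
    length (scale a′ g′ +ₚ (0# ∷ (f′ *ₚ g′)))      ∎

  length-*ₚ-∷ : ∀ a f b g → length ((a ∷ f) *ₚ (b ∷ g)) ≡ suc (length f ℕ.+ length g)
  length-*ₚ-∷ a [] b g = trans (length-+ₚ (scale a (b ∷ g)) (0# ∷ []))
    (cong suc (trans (ℕP.⊔-identityʳ _) (length-scale a g)))
  length-*ₚ-∷ a (c ∷ f) b g = begin
    length (scale a (b ∷ g) +ₚ (0# ∷ ((c ∷ f) *ₚ (b ∷ g))))
      ≡⟨ length-+ₚ (scale a (b ∷ g)) (0# ∷ ((c ∷ f) *ₚ (b ∷ g))) ⟩
    suc (length (scale a g) ⊔ length ((c ∷ f) *ₚ (b ∷ g)))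
      ≡⟨ cong₂ (λ u v → suc (u ⊔ v)) (length-scale a g) (length-*ₚ-∷ c f b g) ⟩
    suc (length g ⊔ suc (length f ℕ.+ length g))
      ≡⟨ cong suc (ℕP.m≤n⇒m⊔n≡n (ℕP.m≤n⇒m≤1+n (ℕP.m≤n+m (length g) (length f)))) ⟩
    suc (suc (length f ℕ.+ length g)) ∎

  ≈∧length⇒≡ : ∀ {f g} → f ≈ₚ g → length f ≡ length g → f ≡ g
  ≈∧length⇒≡ {[]} {[]} _ _ = refl
  ≈∧length⇒≡ {a ∷ f} {b ∷ g} f≈g |f|≡|g| =
    cong₂ _∷_ (coeff-≡ f≈g zero) (≈∧length⇒≡ (∷-injectiveʳ f≈g) (ℕP.suc-injective |f|≡|g|))

  length-*ₚ : ∀ f g {m n} → length f ≡ suc m → length g ≡ suc n → length (f *ₚ g) ≡ suc (m ℕ.+ n)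
  length-*ₚ (a ∷ f) (b ∷ g) refl refl = length-*ₚ-∷ a f b g

  scale-*ₚ : ∀ c f g → scale c f *ₚ g ≡ scale c (f *ₚ g)
  scale-*ₚ c f g = ≈∧length⇒≡ (scale-*ₚ-≈ c f g)
    (trans (length-*ₚ-cong (scale c f) f g g (length-scale c f) refl) (sym (length-scale c (f *ₚ g))))

  *ₚ-scale : ∀ f c g → f *ₚ scale c g ≡ scale c (f *ₚ g)
  *ₚ-scale f c g = ≈∧length⇒≡
    (≈-trans (*ₚ-comm-≈ f (scale c g)) (≈-trans (scale-*ₚ-≈ c g f) (scale-cong c (*ₚ-comm-≈ g f))))
    (trans (length-*ₚ-cong f f (scale c g) g refl (length-scale c g)) (sym (length-scale c (f *ₚ g))))

  *ₚ-comm : ∀ f g → f ≢ [] → g ≢ [] → f *ₚ g ≡ g *ₚ f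
  *ₚ-comm [] g f≢[] _ = ⊥-elim (f≢[] refl)
  *ₚ-comm (a ∷ f) [] _ g≢[] = ⊥-elim (g≢[] refl)
  *ₚ-comm (a ∷ f) (b ∷ g) _ _ = ≈∧length⇒≡ (*ₚ-comm-≈ (a ∷ f) (b ∷ g)) (begin
    length ((a ∷ f) *ₚ (b ∷ g))   ≡⟨ length-*ₚ-∷ a f b g ⟩
    suc (length f ℕ.+ length g)   ≡⟨ cong suc (ℕP.+-comm (length f) (length g)) ⟩
    suc (length g ℕ.+ length f)   ≡⟨ length-*ₚ-∷ b g a f ⟨
    length ((b ∷ g) *ₚ (a ∷ f))   ∎)

  *ₚ-assoc : ∀ f g h → f ≢ [] → g ≢ [] → h ≢ [] → (f *ₚ g) *ₚ h ≡ f *ₚ (g *ₚ h)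
  *ₚ-assoc [] g h f≢[] _ _ = ⊥-elim (f≢[] refl)
  *ₚ-assoc (a ∷ f) [] h _ g≢[] _ = ⊥-elim (g≢[] refl)
  *ₚ-assoc (a ∷ f) (b ∷ g) [] _ _ h≢[] = ⊥-elim (h≢[] refl)
  *ₚ-assoc (a ∷ f) (b ∷ g) (c ∷ h) _ _ _ = ≈∧length⇒≡ (*ₚ-assoc-≈ (a ∷ f) (b ∷ g) (c ∷ h)) (begin
    length (((a ∷ f) *ₚ (b ∷ g)) *ₚ (c ∷ h))
      ≡⟨ length-*ₚ ((a ∷ f) *ₚ (b ∷ g)) (c ∷ h) (length-*ₚ-∷ a f b g) refl ⟩
    suc (length f ℕ.+ length g ℕ.+ length h)
      ≡⟨ cong suc (ℕP.+-assoc (length f) (length g) (length h)) ⟩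
    suc (length f ℕ.+ (length g ℕ.+ length h))
      ≡⟨ length-*ₚ (a ∷ f) ((b ∷ g) *ₚ (c ∷ h)) refl (length-*ₚ-∷ b g c h) ⟨
    length ((a ∷ f) *ₚ ((b ∷ g) *ₚ (c ∷ h))) ∎)

  lead : Poly → K
  lead [] = 0#
  lead (a ∷ []) = a
  lead (a ∷ b ∷ f) = lead (b ∷ f)

  lead≡coeff : ∀ f → lead f ≡ coeff f (ℕ.pred (length f))
  lead≡coeff [] = refl
  lead≡coeff (a ∷ []) = refl
  lead≡coeff (a ∷ b ∷ f) = lead≡coeff (b ∷ f)

  lead-++ : ∀ cs c → lead (cs ++ c ∷ []) ≡ c
  lead-++ [] c = refl
  lead-++ (a ∷ []) c = refl
  lead-++ (a ∷ b ∷ cs) c = lead-++ (b ∷ cs) c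

  ∷≡init++lead : ∀ a f → ∃[ cs ] (a ∷ f ≡ cs ++ lead (a ∷ f) ∷ [])
  ∷≡init++lead a [] = [] , refl
  ∷≡init++lead a (b ∷ f) = let cs , b∷f≡cs++l = ∷≡init++lead b f in a ∷ cs , cong (a ∷_) b∷f≡cs++l

  All⇒lead : ∀ {P : Pred K 0ℓ} a f → All P (a ∷ f) → P (lead (a ∷ f))
  All⇒lead a f all = let cs , a∷f≡cs++l = ∷≡init++lead a f in
    All.head (AllP.++⁻ʳ cs (subst (All _) a∷f≡cs++l all))

  monic⇒lead≡1 : ∀ {g} → MonicFq g → lead g ≡ 1#
  monic⇒lead≡1 (_ , cs , refl) = lead-++ cs 1#

  lead-xⁿ-1 : ∀ n → lead (xⁿ-1 n) ≡ 1#
  lead-xⁿ-1 n = lead-++ ((- 1#) ∷ List.replicate (ℕ.pred n) 0#) 1#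

  lead-≈[] : ∀ {f} → f ≈ₚ [] → lead f ≡ 0#
  lead-≈[] {f} f≈0 = trans (lead≡coeff f) (coeff-≡ f≈0 _)

  coeff-≥length : ∀ f {i} → length f ≤ i → coeff f i ≡ 0#
  coeff-≥length [] _ = refl
  coeff-≥length (a ∷ f) (s≤s |f|≤i) = coeff-≥length f |f|≤i

  coeff-*ₚ-top : ∀ a f b g → coeff ((a ∷ f) *ₚ (b ∷ g)) (length f ℕ.+ length g)
                           ≡ coeff (a ∷ f) (length f) * coeff (b ∷ g) (length g)
  coeff-*ₚ-top a [] b g = trans (coeff-*ₚ a [] (b ∷ g) (length g))
    (trans (cong (a * coeff (b ∷ g) (length g) +_) (coeff-≡ (0∷≈[] ≈-refl) (length g)))
           (+-identityʳ _))
  coeff-*ₚ-top a (c ∷ f) b g = begin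
    coeff ((a ∷ c ∷ f) *ₚ (b ∷ g)) (suc (length f ℕ.+ length g))
      ≡⟨ coeff-*ₚ a (c ∷ f) (b ∷ g) (suc (length f ℕ.+ length g)) ⟩
    a * coeff (b ∷ g) (suc (length f ℕ.+ length g)) + coeff ((c ∷ f) *ₚ (b ∷ g)) (length f ℕ.+ length g)
      ≡⟨ cong₂ (λ u v → a * u + v) (coeff-≥length (b ∷ g) (s≤s (ℕP.m≤n+m (length g) (length f))))
                                     (coeff-*ₚ-top c f b g) ⟩
    a * 0# + coeff (c ∷ f) (length f) * coeff (b ∷ g) (length g)
      ≡⟨ trans (cong (_+ coeff (c ∷ f) (length f) * coeff (b ∷ g) (length g)) (zeroʳ a)) (+-identityˡ _) ⟩
    coeff (c ∷ f) (length f) * coeff (b ∷ g) (length g) ∎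

  lead-*ₚ : ∀ a f b g → lead ((a ∷ f) *ₚ (b ∷ g)) ≡ lead (a ∷ f) * lead (b ∷ g)
  lead-*ₚ a f b g = begin
    lead ((a ∷ f) *ₚ (b ∷ g))
      ≡⟨ lead≡coeff ((a ∷ f) *ₚ (b ∷ g)) ⟩
    coeff ((a ∷ f) *ₚ (b ∷ g)) (ℕ.pred (length ((a ∷ f) *ₚ (b ∷ g))))
      ≡⟨ cong (λ n → coeff ((a ∷ f) *ₚ (b ∷ g)) (ℕ.pred n)) (length-*ₚ-∷ a f b g) ⟩
    coeff ((a ∷ f) *ₚ (b ∷ g)) (length f ℕ.+ length g)
      ≡⟨ coeff-*ₚ-top a f b g ⟩
    coeff (a ∷ f) (length f) * coeff (b ∷ g) (length g)
      ≡⟨ cong₂ _*_ (lead≡coeff (a ∷ f)) (lead≡coeff (b ∷ g)) ⟨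
    lead (a ∷ f) * lead (b ∷ g) ∎

  lead≡1⇒nonempty : ∀ f g → lead (f *ₚ g) ≡ 1# →
                    ∃[ a ] ∃[ f′ ] ∃[ b ] ∃[ g′ ] (f ≡ a ∷ f′ × g ≡ b ∷ g′)
  lead≡1⇒nonempty [] g 0≡1 = ⊥-elim (0≢1 0≡1)
  lead≡1⇒nonempty (a ∷ f) [] l≡1 = ⊥-elim (0≢1 (trans (sym (lead-≈[] (*ₚ-zeroʳ (a ∷ f)))) l≡1))
  lead≡1⇒nonempty (a ∷ f) (b ∷ g) _ = a , f , b , g , refl , refl

  1≤length⇒≢[] : ∀ {f : Poly} → 1 ≤ length f → f ≢ []
  1≤length⇒≢[] 1≤|f| refl with 1≤|f|
  ... | ()

  monic≢1⇒2≤length : ∀ {h} → MonicFq h → h ≢ oneₚ → 2 ≤ length h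
  monic≢1⇒2≤length (_ , [] , refl) h≢1 = ⊥-elim (h≢1 refl)
  monic≢1⇒2≤length (_ , c ∷ cs , refl) _ =
    s≤s (subst (1 ≤_) (sym (ListP.length-++ cs)) (ℕP.m≤n+m 1 (length cs)))

  length≤length-*ₚˡ : ∀ f g → 1 ≤ length g → length f ≤ length (f *ₚ g)
  length≤length-*ₚˡ [] g _ = z≤n
  length≤length-*ₚˡ (a ∷ f) (b ∷ g) _ = ℕP.≤-trans (s≤s (ℕP.m≤m+n (length f) (length g)))
                                                     (ℕP.≤-reflexive (sym (length-*ₚ-∷ a f b g)))

  length≤length-*ₚʳ : ∀ f g → 1 ≤ length f → length g ≤ length (f *ₚ g)
  length≤length-*ₚʳ (a ∷ f) [] _ = z≤n
  length≤length-*ₚʳ (a ∷ f) (b ∷ g) _ = ℕP.≤-trans (s≤s (ℕP.m≤n+m (length g) (length f)))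
                                                     (ℕP.≤-reflexive (sym (length-*ₚ-∷ a f b g)))

  length<length-*ₚˡ : ∀ f g → 1 ≤ length f → 2 ≤ length g → length f < length (f *ₚ g)
  length<length-*ₚˡ (a ∷ f) (b ∷ []) _ (s≤s ())
  length<length-*ₚˡ (a ∷ f) (b ∷ c ∷ g) _ _ = ℕP.≤-trans
    (s≤s (ℕP.≤-trans (ℕP.≤-reflexive (ℕP.+-comm 1 (length f))) (ℕP.+-monoʳ-≤ (length f) (s≤s z≤n))))
    (ℕP.≤-reflexive (sym (length-*ₚ-∷ a f b (c ∷ g))))

  scale-scale : ∀ c d f → scale c (scale d f) ≡ scale (c * d) f
  scale-scale c d f = trans (sym (ListP.map-∘ f)) (ListP.map-cong (λ x → sym (*-assoc c d x)) f)

  scale-1 : ∀ f → scale 1# f ≡ f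
  scale-1 f = trans (ListP.map-cong *-identityˡ f) (ListP.map-id f)

module ModuleAction (F : FiniteField) (q : ℕ) (^q-additive : FrobeniusAdditive F q) where
  open FiniteField F
  open FieldDefs F q

  open FieldArithmetic F q
    using ( commutativeSemiring; +-group; +-identityˡ; +-identityʳ; *-assoc; *-comm; *-identityˡ; *-identityʳ
          ; zeroˡ; zeroʳ; ^-distrib-*; 1^n≡1 )
  open Polynomials F q using (scale)
  open import Algebra.Solver.Ring.NaturalCoefficients.Default commutativeSemiring
  open ≡-Reasoning

  InFq-0 : InFq 0#
  InFq-0 = GroupProperties.identityʳ-unique +-group (0# ^ q) (0# ^ q)
    (sym (trans (cong (_^ q) (sym (+-identityʳ 0#))) (^q-additive 0# 0#)))

  InFq-1 : InFq 1#
  InFq-1 = 1^n≡1 q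

  InFq-+ : ∀ {a b} → InFq a → InFq b → InFq (a + b)
  InFq-+ {a} {b} a∈Fq b∈Fq = trans (^q-additive a b) (cong₂ _+_ a∈Fq b∈Fq)

  InFq-* : ∀ {a b} → InFq a → InFq b → InFq (a * b)
  InFq-* {a} {b} a∈Fq b∈Fq = trans (^-distrib-* a b q) (cong₂ _*_ a∈Fq b∈Fq)

  InFq-inverse : ∀ {c d} → InFq c → c * d ≡ 1# → InFq d
  InFq-inverse {c} {d} c∈Fq cd≡1 = begin
    d ^ q                 ≡⟨ *-identityʳ (d ^ q) ⟨
    d ^ q * 1#            ≡⟨ cong (d ^ q *_) cd≡1 ⟨
    d ^ q * (c * d)       ≡⟨ *-assoc (d ^ q) c d ⟨
    (d ^ q * c) * d       ≡⟨ cong (λ c′ → (d ^ q * c′) * d) c∈Fq ⟨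
    (d ^ q * c ^ q) * d   ≡⟨ cong (_* d) (^-distrib-* d c q) ⟨
    (d * c) ^ q * d       ≡⟨ cong (λ x → x ^ q * d) (trans (*-comm d c) cd≡1) ⟩
    1# ^ q * d            ≡⟨ cong (_* d) InFq-1 ⟩
    1# * d                ≡⟨ *-identityˡ d ⟩
    d                     ∎

  InFqPoly-scale : ∀ {c f} → InFq c → InFqPoly f → InFqPoly (scale c f)
  InFqPoly-scale c∈Fq = AllP.map⁺ ∘ All.map (InFq-* c∈Fq)

  InFqPoly-+ₚ : ∀ {f g} → InFqPoly f → InFqPoly g → InFqPoly (f +ₚ g)
  InFqPoly-+ₚ [] g∈Fq = g∈Fq
  InFqPoly-+ₚ (a∈Fq ∷ f∈Fq) [] = a∈Fq ∷ f∈Fq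
  InFqPoly-+ₚ (a∈Fq ∷ f∈Fq) (b∈Fq ∷ g∈Fq) = InFq-+ a∈Fq b∈Fq ∷ InFqPoly-+ₚ f∈Fq g∈Fq

  InFqPoly-*ₚ : ∀ {f g} → InFqPoly f → InFqPoly g → InFqPoly (f *ₚ g)
  InFqPoly-*ₚ [] g∈Fq = []
  InFqPoly-*ₚ (a∈Fq ∷ f∈Fq) g∈Fq =
    InFqPoly-+ₚ (InFqPoly-scale a∈Fq g∈Fq) (InFq-0 ∷ InFqPoly-*ₚ f∈Fq g∈Fq)

  ^q-*-InFq : ∀ {c} x → InFq c → (c * x) ^ q ≡ c * x ^ q
  ^q-*-InFq {c} x c∈Fq = trans (^-distrib-* c x q) (cong (_* x ^ q) c∈Fq)

  ∘ₚ-+ₚ : ∀ f g α → (f +ₚ g) ∘ₚ α ≡ f ∘ₚ α + g ∘ₚ α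
  ∘ₚ-+ₚ [] g α = sym (+-identityˡ _)
  ∘ₚ-+ₚ (a ∷ f) [] α = sym (+-identityʳ _)
  ∘ₚ-+ₚ (a ∷ f) (b ∷ g) α = begin
    (a + b) * α + (f +ₚ g) ∘ₚ (α ^ q)
      ≡⟨ cong ((a + b) * α +_) (∘ₚ-+ₚ f g (α ^ q)) ⟩
    (a + b) * α + (f ∘ₚ (α ^ q) + g ∘ₚ (α ^ q))
      ≡⟨ solve 5 (λ a b x u v → (a :+ b) :* x :+ (u :+ v) := (a :* x :+ u) :+ (b :* x :+ v)) refl a b α _ _ ⟩
    (a * α + f ∘ₚ (α ^ q)) + (b * α + g ∘ₚ (α ^ q)) ∎

  ∘ₚ-scale : ∀ c f α → scale c f ∘ₚ α ≡ c * (f ∘ₚ α)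
  ∘ₚ-scale c [] α = sym (zeroʳ c)
  ∘ₚ-scale c (a ∷ f) α = begin
    c * a * α + scale c f ∘ₚ (α ^ q)
      ≡⟨ cong (c * a * α +_) (∘ₚ-scale c f (α ^ q)) ⟩
    c * a * α + c * (f ∘ₚ (α ^ q))
      ≡⟨ solve 4 (λ c a x y → c :* a :* x :+ c :* y := c :* (a :* x :+ y)) refl c a α _ ⟩
    c * (a * α + f ∘ₚ (α ^ q)) ∎

  ∘ₚ-^q : ∀ f α → InFqPoly f → (f ∘ₚ α) ^ q ≡ f ∘ₚ (α ^ q)
  ∘ₚ-^q [] α _ = InFq-0
  ∘ₚ-^q (a ∷ f) α (a∈Fq ∷ f∈Fq) = begin
    (a * α + f ∘ₚ (α ^ q)) ^ q         ≡⟨ ^q-additive _ _ ⟩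
    (a * α) ^ q + (f ∘ₚ (α ^ q)) ^ q   ≡⟨ cong₂ _+_ (^q-*-InFq α a∈Fq) (∘ₚ-^q f (α ^ q) f∈Fq) ⟩
    a * α ^ q + f ∘ₚ ((α ^ q) ^ q)     ∎

  ∘ₚ-*ₚ : ∀ f g γ → InFqPoly g → (f *ₚ g) ∘ₚ γ ≡ f ∘ₚ (g ∘ₚ γ)
  ∘ₚ-*ₚ [] g γ _ = refl
  ∘ₚ-*ₚ (a ∷ f) g γ g∈Fq = begin
    (scale a g +ₚ (0# ∷ (f *ₚ g))) ∘ₚ γ
      ≡⟨ ∘ₚ-+ₚ (scale a g) (0# ∷ (f *ₚ g)) γ ⟩
    scale a g ∘ₚ γ + (0# * γ + (f *ₚ g) ∘ₚ (γ ^ q))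
      ≡⟨ cong₂ _+_ (∘ₚ-scale a g γ) (trans (cong (_+ (f *ₚ g) ∘ₚ (γ ^ q)) (zeroˡ γ)) (+-identityˡ _)) ⟩
    a * (g ∘ₚ γ) + (f *ₚ g) ∘ₚ (γ ^ q)
      ≡⟨ cong (a * (g ∘ₚ γ) +_) (∘ₚ-*ₚ f g (γ ^ q) g∈Fq) ⟩
    a * (g ∘ₚ γ) + f ∘ₚ (g ∘ₚ (γ ^ q))
      ≡⟨ cong (λ x → a * (g ∘ₚ γ) + f ∘ₚ x) (∘ₚ-^q g γ g∈Fq) ⟨
    a * (g ∘ₚ γ) + f ∘ₚ ((g ∘ₚ γ) ^ q) ∎

  ∘ₚ-*ˡ : ∀ f c δ → InFq c → f ∘ₚ (c * δ) ≡ c * (f ∘ₚ δ)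
  ∘ₚ-*ˡ [] c δ _ = sym (zeroʳ c)
  ∘ₚ-*ˡ (a ∷ f) c δ c∈Fq = begin
    a * (c * δ) + f ∘ₚ ((c * δ) ^ q)
      ≡⟨ cong (λ x → a * (c * δ) + f ∘ₚ x) (^q-*-InFq δ c∈Fq) ⟩
    a * (c * δ) + f ∘ₚ (c * δ ^ q)
      ≡⟨ cong (a * (c * δ) +_) (∘ₚ-*ˡ f c (δ ^ q) c∈Fq) ⟩
    a * (c * δ) + c * (f ∘ₚ (δ ^ q))
      ≡⟨ solve 4 (λ a c d y → a :* (c :* d) :+ c :* y := c :* (a :* d :+ y)) refl a c δ _ ⟩
    c * (a * δ + f ∘ₚ (δ ^ q)) ∎

  scale-∘ₚ : ∀ {c} f δ → InFq c → scale c f ∘ₚ δ ≡ f ∘ₚ (c * δ)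
  scale-∘ₚ {c} f δ c∈Fq = trans (∘ₚ-scale c f δ) (sym (∘ₚ-*ˡ f c δ c∈Fq))

module MultiplicativeFreeness (F : FiniteField) (q : ℕ) where
  open FiniteField F
  open FieldDefs F q
  open FieldArithmetic F q using (^-*-assoc)

  EFree-∣ : ∀ {e e′ x} → e ∣ e′ → EFree e′ x → EFree e x
  EFree-∣ e∣e′ (x≢0 , e′-free) = x≢0 , λ d d∣e → e′-free d (∣-trans d∣e e∣e′)

  no-prime-power-root⇒EFree : ∀ {e x} → e ≢ 0 → x ≢ 0# →
    (∀ p → Prime p → p ∣ e → ¬ (∃[ γ ] (x ≡ γ ^ p))) → EFree e x
  no-prime-power-root⇒EFree {e} {x} e≢0 x≢0 no-root = x≢0 , λ d d∣e d≢1 (γ , x≡γᵈ) →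
    let p , p-prime , divides c d≡c*p = prime-divisor (λ { refl → e≢0 (0∣⇒≡0 d∣e) }) d≢1
    in no-root p p-prime (∣-trans (divides c d≡c*p) d∣e)
         (γ ^ c , trans x≡γᵈ (trans (cong (γ ^_) d≡c*p) (sym (^-*-assoc γ c p))))

  EFree-from-prime-multiples : ∀ {N e x} → N ≢ 0 → EFree e x →
    (∀ p → Prime p → p ∣ N → ¬ p ∣ e → EFree (p ℕ.* e) x) → EFree N x
  EFree-from-prime-multiples {e = e} N≢0 (x≢0 , e-free) pe-free =
    no-prime-power-root⇒EFree N≢0 x≢0 λ p p-prime p∣N → case p ∣? e of λ
      { (yes p∣e) → e-free p p∣e (p≢1 p-prime)
      ; (no p∤e) → proj₂ (pe-free p p-prime p∣N p∤e) p (m∣m*n e) (p≢1 p-prime) }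
    where
    p≢1 : ∀ {p} → Prime p → p ≢ 1
    p≢1 p-prime refl = ¬prime[1] p-prime

module AdditiveFreeness (F : FiniteField) (q : ℕ) (^q-additive : FrobeniusAdditive F q) where
  open FiniteField F
  open FieldDefs F q

  open FieldArithmetic F q using (*-comm; zeroˡ)
  open Polynomials F q
  open ModuleAction F q ^q-additive
  open ≡-Reasoning

  polys≤ : ℕ → List Poly
  polys≤ zero = [] ∷ []
  polys≤ (suc L) = [] ∷ List.concatMap (λ a → map (a ∷_) (polys≤ L)) elems

  polys≤-complete : ∀ L f → length f ≤ L → f ∈ polys≤ L
  polys≤-complete zero [] _ = here refl
  polys≤-complete (suc L) [] _ = here refl
  polys≤-complete (suc L) (a ∷ f) (s≤s |f|≤L) = there (∈-concatMap⁺ (λ a → map (a ∷_) (polys≤ L))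
    (lose (elems-complete a) (∈-map⁺ (a ∷_) (polys≤-complete L f |f|≤L))))

  bounded-∃? : ∀ {P : Pred Poly 0ℓ} L → Decidable P → (∀ {f} → P f → length f ≤ L) → Dec (∃ P)
  bounded-∃? L P? bounded with Any.any? P? (polys≤ L)
  ... | yes any = yes (Any.satisfied any)
  ... | no ¬any = no λ (f , Pf) → ¬any (lose (polys≤-complete L f (bounded Pf)) Pf)

  InFqPoly? : Decidable InFqPoly
  InFqPoly? = All.all? (λ x → (x ^ q) ≟ x)

  _≟ₚ_ : DecidableEquality Poly
  _≟ₚ_ = ListP.≡-dec _≟_

  ∣ₚ? : ∀ {g} → lead g ≡ 1# → ∀ h → Dec (h ∣ₚ g)
  ∣ₚ? {g} lead≡1 h = bounded-∃? (length g)
    (λ k → InFqPoly? k ×-dec ((h *ₚ k) ≟ₚ g))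
    (λ { {k} (_ , hk≡g) → bound k hk≡g })
    where
    bound : ∀ k → h *ₚ k ≡ g → length k ≤ length g
    bound k hk≡g with lead≡1⇒nonempty h k (trans (cong lead hk≡g) lead≡1)
    ... | _ , _ , _ , _ , refl , refl =
      subst (length k ≤_) (cong length hk≡g) (length≤length-*ₚʳ h k (s≤s z≤n))

  ProperFactorisation : Poly → Poly → Poly → Set
  ProperFactorisation h a b = InFqPoly a × InFqPoly b × 2 ≤ length a × 2 ≤ length b × a *ₚ b ≡ h

  properFactorisation? : ∀ h → Dec (∃[ a ] ∃[ b ] ProperFactorisation h a b)
  properFactorisation? h = bounded-∃? (length h)
    (λ a → bounded-∃? (length h) (factorisation? a) (λ { {b} fac → right-bound a b fac }))
    (λ { {a} (b , fac) → left-bound a b fac })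
    where
    factorisation? : ∀ a → Decidable (ProperFactorisation h a)
    factorisation? a b = InFqPoly? a ×-dec InFqPoly? b ×-dec (2 ℕ.≤? length a) ×-dec (2 ℕ.≤? length b)
                         ×-dec ((a *ₚ b) ≟ₚ h)
    left-bound : ∀ a b → ProperFactorisation h a b → length a ≤ length h
    left-bound a b (_ , _ , _ , 2≤|b| , refl) = length≤length-*ₚˡ a b (ℕP.≤-trans (s≤s z≤n) 2≤|b|)
    right-bound : ∀ a b → ProperFactorisation h a b → length b ≤ length h
    right-bound a b (_ , _ , 2≤|a| , _ , refl) = length≤length-*ₚʳ a b (ℕP.≤-trans (s≤s z≤n) 2≤|a|)

  ∣ₚ-*ₚ⇒∣ₚ : ∀ {g} a b → lead g ≡ 1# → InFqPoly b → a ≢ [] → b ≢ [] → (a *ₚ b) ∣ₚ g → a ∣ₚ g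
  ∣ₚ-*ₚ⇒∣ₚ a b lead≡1 b∈Fq a≢[] b≢[] (k , k∈Fq , abk≡g)
    with lead≡1⇒nonempty (a *ₚ b) k (trans (cong lead abk≡g) lead≡1)
  ... | _ , _ , _ , _ , _ , refl =
    b *ₚ k , InFqPoly-*ₚ b∈Fq k∈Fq , trans (sym (*ₚ-assoc a b k a≢[] b≢[] (λ ()))) abk≡g

  ∣ₚ⇒∣ₚ-*ₚ : ∀ {g} h f → lead g ≡ 1# → InFqPoly f → f ≢ [] → h ∣ₚ g → h ∣ₚ (f *ₚ g)
  ∣ₚ⇒∣ₚ-*ₚ {g} h f lead≡1 f∈Fq f≢[] (k , k∈Fq , hk≡g)
    with lead≡1⇒nonempty h k (trans (cong lead hk≡g) lead≡1)
  ... | _ , _ , _ , _ , refl , refl = k *ₚ f , InFqPoly-*ₚ k∈Fq f∈Fq , (begin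
    h *ₚ (k *ₚ f)     ≡⟨ *ₚ-assoc h k f (λ ()) (λ ()) f≢[] ⟨
    (h *ₚ k) *ₚ f     ≡⟨ cong (_*ₚ f) hk≡g ⟩
    g *ₚ f            ≡⟨ *ₚ-comm g f g≢[] f≢[] ⟩
    f *ₚ g            ∎)
    where
    g≢[] : g ≢ []
    g≢[] g≡[] = 0≢1 (trans (sym (cong lead g≡[])) lead≡1)

  GFree-*ₚ⇒GFree : ∀ {g f α} → MonicFq g → MonicFq f → GFree (f *ₚ g) α → GFree g α
  GFree-*ₚ⇒GFree {g} {f} g-monic f-monic fg-free h h-monic h∣g =
    fg-free h h-monic (∣ₚ⇒∣ₚ-*ₚ h f (monic⇒lead≡1 g-monic) (proj₁ f-monic) f≢[] h∣g)
    where
    f≢[] : f ≢ []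
    f≢[] f≡[] = 0≢1 (trans (sym (cong lead f≡[])) (monic⇒lead≡1 f-monic))

  monic-multiple : ∀ {h} → InFqPoly h → h ≢ [] → lead h ≢ 0# →
                   ∃[ c ] ∃[ P ] (InFq c × MonicFq P × h ≡ scale c P)
  monic-multiple {[]} _ h≢[] _ = ⊥-elim (h≢[] refl)
  monic-multiple {a ∷ h} h∈Fq _ c≢0 =
    c , scale d (a ∷ h) , c∈Fq , (InFqPoly-scale (InFq-inverse c∈Fq cd≡1) h∈Fq , scale d cs , dh≡cs++1) ,
    (begin
      a ∷ h                     ≡⟨ scale-1 (a ∷ h) ⟨
      scale 1# (a ∷ h)          ≡⟨ cong (λ x → scale x (a ∷ h)) cd≡1 ⟨
      scale (c * d) (a ∷ h)     ≡⟨ scale-scale c d (a ∷ h) ⟨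
      scale c (scale d (a ∷ h)) ∎)
    where
    c d : K
    c = lead (a ∷ h)
    d = proj₁ (inverse c c≢0)
    c∈Fq : InFq c
    c∈Fq = All⇒lead a h h∈Fq
    cd≡1 : c * d ≡ 1#
    cd≡1 = proj₂ (inverse c c≢0)
    cs : List K
    cs = proj₁ (∷≡init++lead a h)
    dh≡cs++1 : scale d (a ∷ h) ≡ scale d cs ++ 1# ∷ []
    dh≡cs++1 = begin
      scale d (a ∷ h)           ≡⟨ cong (scale d) (proj₂ (∷≡init++lead a h)) ⟩
      scale d (cs ++ c ∷ [])    ≡⟨ ListP.map-++ (d *_) cs (c ∷ []) ⟩
      scale d cs ++ d * c ∷ []  ≡⟨ cong (λ x → scale d cs ++ x ∷ []) (trans (*-comm d c) cd≡1) ⟩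
      scale d cs ++ 1# ∷ []     ∎

  divisor-of-monic : ∀ {g h} → lead g ≡ 1# → h ∣ₚ g → h ≢ [] × lead h ≢ 0#
  divisor-of-monic {g} {h} lead≡1 (k , _ , hk≡g) with lead≡1⇒nonempty h k (trans (cong lead hk≡g) lead≡1)
  ... | a , h′ , b , k′ , refl , refl = (λ ()) , λ lead≡0 → 0≢1 (begin
    0#                              ≡⟨ zeroˡ (lead (b ∷ k′)) ⟨
    0# * lead (b ∷ k′)              ≡⟨ cong (_* lead (b ∷ k′)) lead≡0 ⟨
    lead (a ∷ h′) * lead (b ∷ k′)   ≡⟨ lead-*ₚ a h′ b k′ ⟨
    lead ((a ∷ h′) *ₚ (b ∷ k′))     ≡⟨ cong lead hk≡g ⟩
    lead g                          ≡⟨ lead≡1 ⟩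
    1#                              ∎)

  scale∣ₚ⇒∣ₚ : ∀ {c g} P → InFq c → scale c P ∣ₚ g → P ∣ₚ g
  scale∣ₚ⇒∣ₚ {c} {g} P c∈Fq (k , k∈Fq , cPk≡g) = scale c k , InFqPoly-scale c∈Fq k∈Fq , (begin
    P *ₚ scale c k     ≡⟨ *ₚ-scale P c k ⟩
    scale c (P *ₚ k)   ≡⟨ scale-*ₚ c P k ⟨
    scale c P *ₚ k     ≡⟨ cPk≡g ⟩
    g                  ∎)

  unfactorisable-multiple⇒irreducible : ∀ {c P} → InFq c → MonicFq P → 2 ≤ length (scale c P) →
    ¬ (∃[ a ] ∃[ b ] ProperFactorisation (scale c P) a b) → MonicIrreducible P
  unfactorisable-multiple⇒irreducible {c} {P} c∈Fq P-monic 2≤|cP| unfactorisable = P-monic , P≢1 , P-irreducible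
    where
    P≢1 : P ≢ oneₚ
    P≢1 P≡1 = ℕP.<⇒≱ (subst (2 ≤_) (trans (length-scale c P) (cong length P≡1)) 2≤|cP|) ℕP.≤-refl
    P-irreducible : ∀ f f′ → InFqPoly f → InFqPoly f′ → f *ₚ f′ ≡ P → length f ≤ 1 ⊎ length f′ ≤ 1
    P-irreducible f f′ f∈Fq f′∈Fq ff′≡P with length f ℕ.≤? 1 | length f′ ℕ.≤? 1
    ... | yes |f|≤1 | _ = inj₁ |f|≤1
    ... | no _ | yes |f′|≤1 = inj₂ |f′|≤1
    ... | no |f|≰1 | no |f′|≰1 = ⊥-elim (unfactorisable (scale c f , f′ ,
          InFqPoly-scale c∈Fq f∈Fq , f′∈Fq , subst (2 ≤_) (sym (length-scale c f)) (ℕP.≰⇒> |f|≰1) , ℕP.≰⇒> |f′|≰1 ,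
          trans (scale-*ₚ c f f′) (cong (scale c) ff′≡P)))

  module _ {n g α} (g-monic : MonicFq g) (g-free : GFree g α)
           (hg-free : ∀ h → MonicIrreducible h → h ∣ₚ xⁿ-1 n → ¬ h ∣ₚ g → GFree (h *ₚ g) α) where

    irreducible-divisor-not-root : ∀ {P} → MonicIrreducible P → P ∣ₚ xⁿ-1 n → ∀ δ → α ≢ P ∘ₚ δ
    irreducible-divisor-not-root {P} P-irr@(P-monic , P≢1 , _) P∣X δ α≡Pδ
      with ∣ₚ? (monic⇒lead≡1 g-monic) P
    ... | yes P∣g = g-free P P-monic P∣g P≢1 (δ , α≡Pδ)
    ... | no P∤g = hg-free P P-irr P∣X P∤g P P-monic (g , proj₁ g-monic , refl) P≢1 (δ , α≡Pδ)

    unfactorisable-divisor-not-root : ∀ {h} → InFqPoly h → 2 ≤ length h → h ∣ₚ xⁿ-1 n →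
      ¬ (∃[ a ] ∃[ b ] ProperFactorisation h a b) → ∀ δ → α ≢ h ∘ₚ δ
    unfactorisable-divisor-not-root {h} h∈Fq 2≤|h| h∣X unfactorisable δ α≡hδ
      with divisor-of-monic (lead-xⁿ-1 n) h∣X
    ... | h≢[] , lead≢0 with monic-multiple h∈Fq h≢[] lead≢0
    ... | c , P , c∈Fq , P-monic , refl = irreducible-divisor-not-root
      (unfactorisable-multiple⇒irreducible c∈Fq P-monic 2≤|h| unfactorisable)
      (scale∣ₚ⇒∣ₚ P c∈Fq h∣X) (c * δ) (trans α≡hδ (scale-∘ₚ P δ c∈Fq))

    divisor-not-root : ∀ L {h} → length h ≤ L → InFqPoly h → 2 ≤ length h → h ∣ₚ xⁿ-1 n →
                       ∀ δ → α ≢ h ∘ₚ δ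
    divisor-not-root L {h} |h|≤L h∈Fq 2≤|h| h∣X δ with properFactorisation? h
    ... | no unfactorisable = unfactorisable-divisor-not-root h∈Fq 2≤|h| h∣X unfactorisable δ
    ... | yes (a , b , a∈Fq , b∈Fq , 2≤|a| , 2≤|b| , refl) = λ α≡[ab]δ →
      divisor-not-root-factor L |h|≤L (trans α≡[ab]δ (∘ₚ-*ₚ a b δ b∈Fq))
      where
      1≤|a| : 1 ≤ length a
      1≤|a| = ℕP.≤-trans (s≤s z≤n) 2≤|a|
      1≤|b| : 1 ≤ length b
      1≤|b| = ℕP.≤-trans (s≤s z≤n) 2≤|b|
      a∣X : a ∣ₚ xⁿ-1 n
      a∣X = ∣ₚ-*ₚ⇒∣ₚ a b (lead-xⁿ-1 n) b∈Fq (1≤length⇒≢[] 1≤|a|) (1≤length⇒≢[] 1≤|b|) h∣X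
      divisor-not-root-factor : ∀ L → length (a *ₚ b) ≤ L → α ≢ a ∘ₚ (b ∘ₚ δ)
      divisor-not-root-factor zero |ab|≤0 =
        ⊥-elim (ℕP.<⇒≱ (ℕP.≤-trans 2≤|a| (length≤length-*ₚˡ a b 1≤|b|)) (ℕP.≤-trans |ab|≤0 z≤n))
      divisor-not-root-factor (suc L) |ab|≤1+L =
        divisor-not-root L (ℕP.≤-pred (ℕP.≤-trans (length<length-*ₚˡ a b 1≤|a| 2≤|b|) |ab|≤1+L))
                         a∈Fq 2≤|a| a∣X (b ∘ₚ δ)

    GFree-xⁿ-1 : GFree (xⁿ-1 n) α
    GFree-xⁿ-1 h h-monic h∣X h≢1 (δ , α≡hδ) =
      divisor-not-root (length h) ℕP.≤-refl (proj₁ h-monic) (monic≢1⇒2≤length h-monic h≢1) h∣X δ α≡hδ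

module _ (F : FiniteField) (q : ℕ) where
  open FiniteField F
  open FieldDefs F q

  module SievingInequality (n m : ℕ) (^q-additive : FrobeniusAdditive F q) (qⁿ∸1≢0 : q ℕ.^ n ∸ 1 ≢ 0)
    (β : K) (j : Fin m) (e : ℕ) (ps : List ℕ)
    (ps-complete : ∀ p → Prime p → p ∣ (q ℕ.^ n ∸ 1) → ¬ p ∣ e → p ∈ ps)
    (g : Poly) (g-monic : MonicFq g) (hs : List Poly) (hs-monic : All MonicFq hs)
    (hs-complete : ∀ h → MonicIrreducible h → h ∣ₚ xⁿ-1 n → ¬ h ∣ₚ g → h ∈ hs)
    (N : (Fin m → ℕ) → Poly → ℕ) (N-card : ∀ es g′ → HasCard (NSet m β j es g′) (N es g′)) where

    open MultiplicativeFreeness F q using (EFree-∣; EFree-from-prime-multiples)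
    open AdditiveFreeness F q ^q-additive using (GFree-xⁿ-1; GFree-*ₚ⇒GFree)
    open Counting _≟_ elems elems-unique elems-complete using (sieve)

    ē : Fin m → ℕ
    ē _ = e

    S T : Pred K 0ℓ
    S = NSet m β j ē g
    T = NSet m β j (λ _ → q ℕ.^ n ∸ 1) (xⁿ-1 n)

    prime-sum polynomial-sum : ℕ
    prime-sum = sum (map (λ k → sum (map (λ p → N (setAt ē k (p ℕ.* e)) g) ps)) (allFin m))
    polynomial-sum = sum (map (λ h → N ē (h *ₚ g)) hs)

    prime-indices polynomial-indices indices : List ((Fin m → ℕ) × Poly)
    prime-indices = cartesianProductWith (λ k p → setAt ē k (p ℕ.* e) , g) (allFin m) ps
    polynomial-indices = map (λ h → ē , h *ₚ g) hs
    indices = prime-indices ++ polynomial-indices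

    N-indices⊆S : All (λ (es , g′) → NSet m β j es g′ ⊆ S) indices
    N-indices⊆S = AllP.++⁺ (All-cartesianProductWith⁺ _ prime-index⊆S (allFin m) ps)
                           (AllP.map⁺ (All.map polynomial-index⊆S hs-monic))
      where
      prime-index⊆S : ∀ k p → NSet m β j (setAt ē k (p ℕ.* e)) g ⊆ S
      prime-index⊆S k p (e-free , g-free) = (λ i → EFree-∣ (e∣ i) (e-free i)) , g-free
        where
        e∣ : ∀ i → e ∣ setAt ē k (p ℕ.* e) i
        e∣ = setAt-preserves ē k (p ℕ.* e) {e ∣_} (n∣m*n p) (λ _ → ∣-refl)
      polynomial-index⊆S : ∀ {h} → MonicFq h → NSet m β j ē (h *ₚ g) ⊆ S
      polynomial-index⊆S h-monic (e-free , hg-free) = e-free , GFree-*ₚ⇒GFree g-monic h-monic hg-free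

    S∩N-indices⊆T : ∀ {x} → S x → All (λ (es , g′) → NSet m β j es g′ x) indices → T x
    S∩N-indices⊆T {x} (e-free , g-free) in-all = qⁿ∸1-free , GFree-xⁿ-1 {n = n} g-monic g-free hg-free
      where
      in-prime : ∀ {k p} → k ∈ allFin m → p ∈ ps → NSet m β j (setAt ē k (p ℕ.* e)) g x
      in-prime = All-cartesianProductWith⁻ _ (allFin m) ps (AllP.++⁻ˡ prime-indices in-all)
      in-polynomial : All (λ h → NSet m β j ē (h *ₚ g) x) hs
      in-polynomial = AllP.map⁻ (AllP.++⁻ʳ prime-indices in-all)
      qⁿ∸1-free : ∀ i → EFree (q ℕ.^ n ∸ 1) (x + toℕ i · β)
      qⁿ∸1-free i = EFree-from-prime-multiples qⁿ∸1≢0 (e-free i) λ p p-prime p∣qⁿ∸1 p∤e →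
        subst (λ d → EFree d (x + toℕ i · β)) (setAt-self ē i (p ℕ.* e))
          (proj₁ (in-prime (∈-allFin i) (ps-complete p p-prime p∣qⁿ∸1 p∤e)) i)
      hg-free : ∀ h → MonicIrreducible h → h ∣ₚ xⁿ-1 n → ¬ h ∣ₚ g → GFree (h *ₚ g) (x + toℕ j · β)
      hg-free h h-irr h∣X h∤g = proj₂ (All.lookup in-polynomial (hs-complete h h-irr h∣X h∤g))

    sum-N-indices : sum (map (uncurry N) indices) ≡ prime-sum ℕ.+ polynomial-sum
    sum-N-indices = begin
      sum (map (uncurry N) (prime-indices ++ polynomial-indices))
        ≡⟨ cong sum (ListP.map-++ (uncurry N) prime-indices polynomial-indices) ⟩
      sum (map (uncurry N) prime-indices ++ map (uncurry N) polynomial-indices)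
        ≡⟨ sum-++ (map (uncurry N) prime-indices) _ ⟩
      sum (map (uncurry N) prime-indices) ℕ.+ sum (map (uncurry N) polynomial-indices)
        ≡⟨ cong₂ ℕ._+_ (sum-map-cartesianProductWith _ (uncurry N) (allFin m) ps)
                       (cong sum (sym (ListP.map-∘ hs))) ⟩
      prime-sum ℕ.+ polynomial-sum ∎
      where
      open ≡-Reasoning

    length-indices : length indices ≡ m ℕ.* length ps ℕ.+ length hs
    length-indices = begin
      length (prime-indices ++ polynomial-indices)         ≡⟨ ListP.length-++ prime-indices ⟩
      length prime-indices ℕ.+ length polynomial-indices
        ≡⟨ cong₂ ℕ._+_ length-prime-indices (ListP.length-map _ hs) ⟩
      m ℕ.* length ps ℕ.+ length hs                        ∎
      where
      open ≡-Reasoning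
      length-prime-indices : length prime-indices ≡ m ℕ.* length ps
      length-prime-indices = trans (length-cartesianProductWith _ (allFin m) ps)
                                   (cong (ℕ._* length ps) (ListP.length-tabulate {n = m} id))

    sieving-inequality : prime-sum ℕ.+ polynomial-sum ℕ.+ N ē g
                         ≤ N (λ _ → q ℕ.^ n ∸ 1) (xⁿ-1 n) ℕ.+ (m ℕ.* length ps ℕ.+ length hs) ℕ.* N ē g
    sieving-inequality = subst₂ (λ a l → a ℕ.+ N ē g ≤ N (λ _ → q ℕ.^ n ∸ 1) (xⁿ-1 n) ℕ.+ l ℕ.* N ē g)
      sum-N-indices length-indices
      (sieve (N-card ē g) (N-card _ (xⁿ-1 n)) (uncurry N-card) N-indices⊆S S∩N-indices⊆T)

open import Data.Integer as ℤ using (ℤ; +_)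
import Data.Integer.Properties as ℤP
import Data.Integer.Solver

ℕ-sieve⇒ℤ-sieve : ∀ a b s t M → a ℕ.+ b ℕ.+ s ≤ t ℕ.+ M ℕ.* s →
                  + a ℤ.+ + b ℤ.- (+ M ℤ.- + 1) ℤ.* + s ℤ.≤ + t
ℕ-sieve⇒ℤ-sieve a b s t M a+b+s≤t+Ms = begin
  + a ℤ.+ + b ℤ.- (+ M ℤ.- + 1) ℤ.* + s
    ≡⟨ solve 4 (λ a b s M → a :+ b :- (M :- con (+ 1)) :* s := a :+ b :+ s :- M :* s) refl (+ a) (+ b) (+ s) (+ M) ⟩
  + a ℤ.+ + b ℤ.+ + s ℤ.- + M ℤ.* + s
    ≡⟨ cong₂ ℤ._-_ (trans (cong (ℤ._+ + s) (ℤP.pos-+ a b)) (ℤP.pos-+ (a ℕ.+ b) s)) (ℤP.pos-* M s) ⟨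
  + (a ℕ.+ b ℕ.+ s) ℤ.- + (M ℕ.* s)
    ≤⟨ ℤP.+-monoˡ-≤ (ℤ.- + (M ℕ.* s)) (ℤ.+≤+ a+b+s≤t+Ms) ⟩
  + (t ℕ.+ M ℕ.* s) ℤ.- + (M ℕ.* s)
    ≡⟨ cong (ℤ._- + (M ℕ.* s)) (ℤP.pos-+ t (M ℕ.* s)) ⟩
  + t ℤ.+ + (M ℕ.* s) ℤ.- + (M ℕ.* s)
    ≡⟨ solve 2 (λ t u → t :+ u :- u := t) refl (+ t) (+ (M ℕ.* s)) ⟩
  + t ∎
  where
  open ℤP.≤-Reasoning
  open Data.Integer.Solver.+-*-Solver using (solve; _:+_; _:-_; _:*_; _:=_; con)

lemma3 : (F : FiniteField) (q n m : ℕ) → IsPrimePower q → 2 ≤ n → 1 ≤ m →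
  FiniteField.card F ≡ q ℕ.^ n →
  let open FiniteField F
      open FieldDefs F q
  in (β : K) → β ≢ 0# → (j : Fin m) →
     (e : ℕ) → e ∣ (q ℕ.^ n ∸ 1) →
     (ps : List ℕ) → Unique ps →
     (∀ p → (p ∈ ps) ⇔ (Prime p × p ∣ (q ℕ.^ n ∸ 1) × ¬ (p ∣ e))) →
     (g : Poly) → MonicFq g → g ∣ₚ xⁿ-1 n →
     (hs : List Poly) → Unique hs →
     (∀ h → (h ∈ hs) ⇔ (MonicIrreducible h × h ∣ₚ xⁿ-1 n × ¬ (h ∣ₚ g))) →
     (N : (Fin m → ℕ) → Poly → ℕ) →
     (∀ es g′ → HasCard (NSet m β j es g′) (N es g′)) →
     let r = length ps
         s = length hs
         ē = λ (_ : Fin m) → e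
     in (+ sum (map (λ k → sum (map (λ p → N (setAt ē k (p ℕ.* e)) g) ps)) (allFin m))
           ℤ.+ + sum (map (λ h → N ē (h *ₚ g)) hs)
           ℤ.- (+ (m ℕ.* r ℕ.+ s) ℤ.- + 1) ℤ.* + N ē g)
        ℤ.≤ + N (λ _ → q ℕ.^ n ∸ 1) (xⁿ-1 n)
lemma3 F q n m (p , k , p-prime , 1≤k , q≡pᵏ) 2≤n _ card≡qⁿ β _ j e _ ps _ ps-spec g g-monic _ hs _ hs-spec N N-card =
  ℕ-sieve⇒ℤ-sieve prime-sum polynomial-sum (N (λ _ → e) g) _ (m ℕ.* length ps ℕ.+ length hs) sieving-inequality
  where
  open FieldDefs F q using (MonicFq; MonicIrreducible; _∣ₚ_; xⁿ-1)
  qⁿ∸1≢0 : q ℕ.^ n ∸ 1 ≢ 0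
  qⁿ∸1≢0 = subst (λ t → t ℕ.^ n ∸ 1 ≢ 0) (sym q≡pᵏ)
    (subst (λ t → t ∸ 1 ≢ 0) (sym (ℕP.^-*-assoc p k n))
      (prime-power∸1≢0 p-prime (ℕP.*-mono-≤ 1≤k (ℕP.≤-trans (s≤s z≤n) 2≤n))))
  ps-complete : ∀ p → Prime p → p ∣ (q ℕ.^ n ∸ 1) → ¬ p ∣ e → p ∈ ps
  ps-complete p p-prime p∣qⁿ∸1 p∤e = Equivalence.from (ps-spec p) (p-prime , p∣qⁿ∸1 , p∤e)
  hs-monic : All MonicFq hs
  hs-monic = All.tabulate λ {h} h∈hs → proj₁ (proj₁ (Equivalence.to (hs-spec h) h∈hs))
  hs-complete : ∀ h → MonicIrreducible h → h ∣ₚ xⁿ-1 n → ¬ h ∣ₚ g → h ∈ hs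
  hs-complete h h-irr h∣X h∤g = Equivalence.from (hs-spec h) (h-irr , h∣X , h∤g)
  ^q-additive : FrobeniusAdditive F q
  ^q-additive = FieldArithmetic.frobenius-additive F q {k = k} {n = n} p-prime q≡pᵏ card≡qⁿ
  open SievingInequality F q n m ^q-additive qⁿ∸1≢0 β j e ps ps-complete g g-monic hs hs-monic hs-complete N N-card
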